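{- Let $q$ be a prime power and $g^{(3)}=q^3-2q+1$. For integers $r,s,t,u$ let \[\Omega_{r,s,t,u}=\Big\{(i,j,k)\in\mathbb{Z}^3 \,\Big|\, -r\le i,\ -s\le i+(q^2+q)k<-s+(q^2+q),\ -t\le qi+(q^2+q)j+(q+1)k<-t+(q^2+q),\ -u\le -q^2i-(q^3-q)j-(q^3+q^2-q-1)k\Big\}.\] For all integers $s,t,u$ there exists a constant $R$ (depending on $s,t,u$) such that for all $r\ge R$, \[\#\Omega_{r,s,t,u}=1-g^{(3)}+r+(q-1)s+(q-1)t+u.\]
   Context: $q$ is a power of a prime; $g^{(3)}=q^3-2q+1$ (the genus of the third function field of the Garcia–Stichtenoth tower over $\mathbb{F}_{q^2}$). -}

module Defs where

open import Data.Nat as ℕ using (ℕ)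
open import Data.Nat.Primality using (Prime)
open import Data.Integer using (ℤ; +_; _+_; _-_; _*_; -_; _≤_; _<_)
open import Data.Product using (Σ; ∃; _×_)
open import Data.List using (List; length)
open import Data.List.Membership.Propositional using (_∈_)
open import Data.List.Relation.Unary.Unique.Propositional using (Unique)
open import Function.Bundles using (_⇔_)
open import Relation.Binary.PropositionalEquality using (_≡_)

IsPrimePower : ℕ → Set
IsPrimePower q = Σ ℕ λ p → Σ ℕ λ m → Prime p × (1 ℕ.≤ m) × (q ≡ p ℕ.^ m)

HasCard : {A : Set} → (A → Set) → ℕ → Set
HasCard {A} P n = Σ (List A) λ L → Unique L × (∀ x → (x ∈ L) ⇔ P x) × (length L ≡ n)

g3 : ℤ → ℤ
g3 q = q * q * q - + 2 * q + + 1

Ω : (q r s t u : ℤ) → ℤ × ℤ × ℤ → Set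
Ω q r s t u (i Data.Product., j Data.Product., k) =
  (- r ≤ i)
  × (- s ≤ i + (q * q + q) * k)
  × (i + (q * q + q) * k < - s + (q * q + q))
  × (- t ≤ q * i + (q * q + q) * j + (q + + 1) * k)
  × (q * i + (q * q + q) * j + (q + + 1) * k < - t + (q * q + q))
  × (- u ≤ - (q * q) * i - (q * q * q - q) * j - (q * q * q + q * q - q - + 1) * k)

module Submission where

-- Write A = i + (q²+q)k and B = qi + (q²+q)j + (q+1)k; the last constraint of Ω is on
-- C = -i - (q-1)(A+B). The two window conditions fix the base-(q+1) digits of A + s and B + t,
-- and since B + t ≡ τ - (A + s) mod q+1 (τ = t - qs) they cut the points into P = q²(q+1) cells.
-- Along a cell the points form a line on which i drops and C grows by P, so for r + u large
-- #Ω = Σ_cells (⌊(i₀+r)/P⌋ + ⌊(C₀+u)/P⌋ + 1) = T(r) + S(u) + P. Increasing r (or u, by the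
-- symmetry σ exchanging (i, A) with (C, B)) adds exactly one point, so T and S are affine of
-- slope 1; averaging r over a period with Hermite's identity gives T(0) + S(0) + P = 1 - g + (q-1)(s+t).

open import Defs
open import Data.Nat as ℕ using (ℕ; zero; suc)
import Data.Nat.Properties as ℕP
open import Data.Nat.Primality using (prime⇒nonZero)
open import Data.Integer as ℤ
  using (ℤ; +_; -[1+_]; _+_; _-_; _*_; -_; _≤_; _<_; +≤+; +<+; 0ℤ; 1ℤ; ∣_∣; _/ℕ_; _%ℕ_)
open import Data.Integer.Properties
open import Data.Integer.DivMod using (a≡a%ℕn+[a/ℕn]*n; n%ℕd<d)
open import Data.Integer.Tactic.RingSolver using (solve-∀)
open import Data.Product using (Σ; _×_; _,_; proj₁; proj₂)
open import Data.Sum using (_⊎_; inj₁; inj₂)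
open import Data.List using (List; []; _∷_; _++_; map; length)
open import Data.List.Properties using (length-++; length-map)
open import Data.List.Membership.Propositional using (_∈_)
open import Data.List.Membership.Propositional.Properties using (∈-++⁺ˡ; ∈-++⁺ʳ; ∈-++⁻; ∈-map⁺; ∈-map⁻)
open import Data.List.Membership.Propositional.Properties.WithK using (unique∧set⇒bag)
open import Data.List.Relation.Unary.Unique.Propositional using (Unique)
open import Data.List.Relation.Unary.Unique.Propositional.Properties using (++⁺; map⁺)
open import Data.List.Relation.Unary.Any using (here; there)
open import Data.List.Relation.Unary.AllPairs using ([]; _∷_)
open import Data.List.Relation.Unary.All using (tabulate)
open import Data.List.Relation.Binary.BagAndSetEquality using (∼bag⇒↭)
open import Data.List.Relation.Binary.Permutation.Propositional.Properties using (↭-length)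
open import Data.Empty using (⊥-elim)
open import Relation.Nullary using (¬_; Dec; yes; no)
open import Function.Base using (_∘_)
open import Function.Bundles using (_⇔_; mk⇔; Equivalence)
open import Relation.Binary.PropositionalEquality

0≤+ : ∀ n → 0ℤ ≤ + n
0≤+ n = +≤+ ℕ.z≤n

0≤* : ∀ {a b} → 0ℤ ≤ a → 0ℤ ≤ b → 0ℤ ≤ a * b
0≤* {+ m} {+ n} _ _ = subst (0ℤ ≤_) (pos-* m n) (0≤+ (m ℕ.* n))

0≤+0≤ : ∀ {a b} → 0ℤ ≤ a → 0ℤ ≤ b → 0ℤ ≤ a + b
0≤+0≤ = +-mono-≤

≤-by-diff : ∀ {x y d} → 0ℤ ≤ d → y - x ≡ d → x ≤ y
≤-by-diff 0≤d eq = 0≤i-j⇒j≤i (subst (0ℤ ≤_) (sym eq) 0≤d)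

<-by-diff : ∀ {x y d} → 0ℤ ≤ d → y - x - 1ℤ ≡ d → x < y
<-by-diff {x} {y} 0≤d eq = suc[i]≤j⇒i<j (≤-by-diff 0≤d (trans (shift x y) eq))
  where
  shift : ∀ x y → y - (1ℤ + x) ≡ y - x - 1ℤ
  shift = solve-∀

<⇒0≤diff-1 : ∀ {x y} → x < y → 0ℤ ≤ y - x - 1ℤ
<⇒0≤diff-1 {x} {y} x<y = subst (0ℤ ≤_) (shift x y) (i≤j⇒0≤j-i (i<j⇒suc[i]≤j x<y))
  where
  shift : ∀ x y → y - (1ℤ + x) ≡ y - x - 1ℤ
  shift = solve-∀

<+1⇒≤ : ∀ {x y} → x < y + 1ℤ → x ≤ y
<+1⇒≤ {x} {y} x<y+1 = ≤-by-diff (<⇒0≤diff-1 x<y+1) (shift x y)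
  where
  shift : ∀ x y → y - x ≡ y + 1ℤ - x - 1ℤ
  shift = solve-∀

≤-respects-diff : ∀ {x y x' y'} → y - x ≡ y' - x' → x ≤ y → x' ≤ y'
≤-respects-diff eq x≤y = 0≤i-j⇒j≤i (subst (0ℤ ≤_) eq (i≤j⇒0≤j-i x≤y))

<-respects-diff : ∀ {x y x' y'} → y - x ≡ y' - x' → x < y → x' < y'
<-respects-diff eq x<y = <-by-diff (<⇒0≤diff-1 x<y) (cong (_- 1ℤ) (sym eq))

-≤⇔-≤ : ∀ {x y} → (- x ≤ y) ⇔ (- y ≤ x)
-≤⇔-≤ {x} {y} = mk⇔ (λ -x≤y → subst (- y ≤_) (neg-involutive x) (neg-mono-≤ -x≤y))
                     (λ -y≤x → subst (- x ≤_) (neg-involutive y) (neg-mono-≤ -y≤x))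

+-cancelʳ : ∀ a b c → a + c ≡ b + c → a ≡ b
+-cancelʳ a b c eq = trans (sym (cancel a c)) (trans (cong (_- c) eq) (cancel b c))
  where
  cancel : ∀ a c → a + c - c ≡ a
  cancel = solve-∀

-- Rewriting with hypotheses inside the ring solver: e ≡ c follows from the
-- polynomial identity e ≡ c + Σ kᵢ (Lᵢ - Rᵢ) together with Lᵢ ≡ Rᵢ.

linear-combination₁ : ∀ {e c L R : ℤ} k → e ≡ c + k * (L - R) → L ≡ R → e ≡ c
linear-combination₁ {c = c} {L} k eq refl =
  trans eq (trans (cong (λ z → c + k * z) (+-inverseʳ L)) (trans (cong (_+_ c) (*-zeroʳ k)) (+-identityʳ c)))

linear-combination₂ : ∀ {e c L₁ R₁ L₂ R₂ : ℤ} k₁ k₂ →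
  e ≡ c + k₁ * (L₁ - R₁) + k₂ * (L₂ - R₂) → L₁ ≡ R₁ → L₂ ≡ R₂ → e ≡ c
linear-combination₂ k₁ k₂ eq h₁ h₂ = linear-combination₁ k₁ (linear-combination₁ k₂ eq h₂) h₁

linear-combination₃ : ∀ {e c L₁ R₁ L₂ R₂ L₃ R₃ : ℤ} k₁ k₂ k₃ →
  e ≡ c + k₁ * (L₁ - R₁) + k₂ * (L₂ - R₂) + k₃ * (L₃ - R₃) → L₁ ≡ R₁ → L₂ ≡ R₂ → L₃ ≡ R₃ → e ≡ c
linear-combination₃ k₁ k₂ k₃ eq h₁ h₂ h₃ = linear-combination₂ k₁ k₂ (linear-combination₁ k₃ eq h₃) h₁ h₂

linear-combination₄ : ∀ {e c L₁ R₁ L₂ R₂ L₃ R₃ L₄ R₄ : ℤ} k₁ k₂ k₃ k₄ →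
  e ≡ c + k₁ * (L₁ - R₁) + k₂ * (L₂ - R₂) + k₃ * (L₃ - R₃) + k₄ * (L₄ - R₄) →
  L₁ ≡ R₁ → L₂ ≡ R₂ → L₃ ≡ R₃ → L₄ ≡ R₄ → e ≡ c
linear-combination₄ k₁ k₂ k₃ k₄ eq h₁ h₂ h₃ h₄ =
  linear-combination₃ k₁ k₂ k₃ (linear-combination₁ k₄ eq h₄) h₁ h₂ h₃

+suc : ∀ n → + suc n ≡ + n + 1ℤ
+suc n = sym (trans (pos-+ n 1) (cong +_ (ℕP.+-comm n 1)))

ℤ-induction : (P : ℤ → Set) → P 0ℤ → (∀ y → P y → P (y + 1ℤ)) → (∀ y → P (y + 1ℤ) → P y) → ∀ y → P y
ℤ-induction P p₀ up down (+ zero)      = p₀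
ℤ-induction P p₀ up down (+ suc n)     = subst P (sym (+suc n)) (up (+ n) (ℤ-induction P p₀ up down (+ n)))
ℤ-induction P p₀ up down -[1+ zero ]   = down -[1+ zero ] p₀
ℤ-induction P p₀ up down -[1+ suc n ]  = down -[1+ suc n ] (ℤ-induction P p₀ up down -[1+ n ])

constant-step⇒affine : (F : ℤ → ℤ) (k : ℤ) → (∀ y → F (y + 1ℤ) ≡ F y + k) → ∀ y → F y ≡ F 0ℤ + y * k
constant-step⇒affine F k step = ℤ-induction (λ y → F y ≡ F 0ℤ + y * k) (base (F 0ℤ) k)
  (λ y ih → trans (step y) (trans (cong (_+ k) ih) (next (F 0ℤ) y k)))
  (λ y ih → +-cancelʳ (F y) (F 0ℤ + y * k) k (trans (sym (step y)) (trans ih (sym (next (F 0ℤ) y k)))))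
  where
  base : ∀ a k → a ≡ a + 0ℤ * k
  base = solve-∀
  next : ∀ a y k → a + y * k + k ≡ a + (y + 1ℤ) * k
  next = solve-∀

-- Floor division by a positive natural number

module _ (d : ℕ) .{{_ : ℕ.NonZero d}} where

  private
    quotient-≤ : ∀ x x' m m' → x' ℕ.< d → + x + m * + d ≡ + x' + m' * + d → m ≤ m'
    quotient-≤ x x' m m' x'<d eq = <+1⇒≤ (*-cancelʳ-<-nonNeg (+ d)
      (<-by-diff (0≤+0≤ (<⇒0≤diff-1 (+<+ x'<d)) (0≤+ x))
        (linear-combination₁ (- 1ℤ) (identity (+ d) (+ x) (+ x') m m') eq)))
      where
      identity : ∀ d x x' m m' →
        (m' + 1ℤ) * d - m * d - 1ℤ ≡ (d - x' - 1ℤ + x) + (- 1ℤ) * ((x + m * d) - (x' + m' * d))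
      identity = solve-∀

  /ℕ-%ℕ-unique : ∀ y (x : ℕ) m → x ℕ.< d → y ≡ + x + m * + d → (y /ℕ d ≡ m) × (y %ℕ d ≡ x)
  /ℕ-%ℕ-unique y x m x<d eq = quotients , +-injective (+-cancelʳ _ _ (m * + d) remainders)
    where
    y%d<d = n%ℕd<d y d
    division : + (y %ℕ d) + y /ℕ d * + d ≡ + x + m * + d
    division = trans (sym (a≡a%ℕn+[a/ℕn]*n y d)) eq
    quotients : y /ℕ d ≡ m
    quotients = ≤-antisym (quotient-≤ _ _ _ _ x<d division) (quotient-≤ _ _ _ _ y%d<d (sym division))
    remainders : + (y %ℕ d) + m * + d ≡ + x + m * + d
    remainders = subst (λ z → + (y %ℕ d) + z * + d ≡ + x + m * + d) quotients division

  -/ℕ*≡%ℕ : ∀ y → y - y /ℕ d * + d ≡ + (y %ℕ d)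
  -/ℕ*≡%ℕ y = linear-combination₁ 1ℤ (identity y (+ (y %ℕ d)) (y /ℕ d) (+ d)) (a≡a%ℕn+[a/ℕn]*n y d)
    where
    identity : ∀ y r f d → y - f * d ≡ r + 1ℤ * (y - (r + f * d))
    identity = solve-∀

  ≤/ℕ⇒*≤ : ∀ y m → m ≤ y /ℕ d → m * + d ≤ y
  ≤/ℕ⇒*≤ y m m≤y/d = ≤-trans (*-monoʳ-≤-nonNeg (+ d) m≤y/d)
    (≤-by-diff (0≤+ (y %ℕ d)) (-/ℕ*≡%ℕ y))

  *≤⇒≤/ℕ : ∀ y m → m * + d ≤ y → m ≤ y /ℕ d
  *≤⇒≤/ℕ y m md≤y = <+1⇒≤ (*-cancelʳ-<-nonNeg (+ d)
    (<-by-diff (0≤+0≤ (<⇒0≤diff-1 (+<+ (n%ℕd<d y d))) (i≤j⇒0≤j-i md≤y))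
      (linear-combination₁ (- 1ℤ) (identity (+ d) (+ (y %ℕ d)) (y /ℕ d) m y) (a≡a%ℕn+[a/ℕn]*n y d))))
    where
    identity : ∀ d r f m y → (f + 1ℤ) * d - m * d - 1ℤ ≡ (d - r - 1ℤ + (y - m * d)) + (- 1ℤ) * (y - (r + f * d))
    identity = solve-∀

  ≤/ℕ⇔*≤ : ∀ y m → (m ≤ y /ℕ d) ⇔ (m * + d ≤ y)
  ≤/ℕ⇔*≤ y m = mk⇔ (≤/ℕ⇒*≤ y m) (*≤⇒≤/ℕ y m)

  /ℕ-%ℕ-+d : ∀ y → ((y + + d) /ℕ d ≡ y /ℕ d + 1ℤ) × ((y + + d) %ℕ d ≡ y %ℕ d)
  /ℕ-%ℕ-+d y = /ℕ-%ℕ-unique (y + + d) (y %ℕ d) (y /ℕ d + 1ℤ) (n%ℕd<d y d)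
    (trans (cong (_+ + d) (a≡a%ℕn+[a/ℕn]*n y d)) (identity (+ (y %ℕ d)) (y /ℕ d) (+ d)))
    where
    identity : ∀ r f d → r + f * d + d ≡ r + (f + 1ℤ) * d
    identity = solve-∀

  /ℕ-%ℕ-small : ∀ x → x ℕ.< d → ((+ x) /ℕ d ≡ 0ℤ) × ((+ x) %ℕ d ≡ x)
  /ℕ-%ℕ-small x x<d = /ℕ-%ℕ-unique (+ x) x 0ℤ x<d (sym (+-identityʳ (+ x)))

  0≤+⇒0≤/ℕ+/ℕ+1 : ∀ x y → 0ℤ ≤ x + y → 0ℤ ≤ x /ℕ d + y /ℕ d + 1ℤ
  0≤+⇒0≤/ℕ+/ℕ+1 x y 0≤x+y = i<j⇒suc[i]≤j (*-cancelʳ-<-nonNeg {i = - 1ℤ} (+ d) (<-by-diff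
    (0≤+0≤ (0≤+0≤ (0≤+0≤ 0≤x+y (<⇒0≤diff-1 (+<+ (n%ℕd<d x d)))) (<⇒0≤diff-1 (+<+ (n%ℕd<d y d)))) (0≤+ 1))
    (linear-combination₂ (- 1ℤ) (- 1ℤ) (identity x y (+ (x %ℕ d)) (+ (y %ℕ d)) (x /ℕ d) (y /ℕ d) (+ d))
      (a≡a%ℕn+[a/ℕn]*n x d) (a≡a%ℕn+[a/ℕn]*n y d))))
    where
    identity : ∀ x y rx ry fx fy d → (fx + fy + 1ℤ) * d - (- 1ℤ) * d - 1ℤ
             ≡ (x + y) + (d - rx - 1ℤ) + (d - ry - 1ℤ) + 1ℤ + (- 1ℤ) * (x - (rx + fx * d)) + (- 1ℤ) * (y - (ry + fy * d))
    identity = solve-∀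

-- Finite sums

∑< : ℕ → (ℕ → ℤ) → ℤ
∑< zero    f = 0ℤ
∑< (suc n) f = ∑< n f + f n

syntax ∑< n (λ x → e) = ∑[ x < n ] e

∑-cong : ∀ n {f g : ℕ → ℤ} → (∀ x → x ℕ.< n → f x ≡ g x) → ∑< n f ≡ ∑< n g
∑-cong zero    f≡g = refl
∑-cong (suc n) f≡g = cong₂ _+_ (∑-cong n (λ x x<n → f≡g x (ℕP.m≤n⇒m≤1+n x<n))) (f≡g n ℕP.≤-refl)

∑-distrib-+ : ∀ n (f g : ℕ → ℤ) → ∑[ x < n ] (f x + g x) ≡ ∑< n f + ∑< n g
∑-distrib-+ zero    f g = refl
∑-distrib-+ (suc n) f g = trans (cong (_+ (f n + g n)) (∑-distrib-+ n f g)) (regroup (∑< n f) (∑< n g) (f n) (g n))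
  where
  regroup : ∀ a b c d → a + b + (c + d) ≡ a + c + (b + d)
  regroup = solve-∀

∑-*ˡ : ∀ n c (f : ℕ → ℤ) → ∑[ x < n ] (c * f x) ≡ c * ∑< n f
∑-*ˡ zero    c f = sym (*-zeroʳ c)
∑-*ˡ (suc n) c f = trans (cong (_+ c * f n) (∑-*ˡ n c f)) (sym (*-distribˡ-+ c (∑< n f) (f n)))

∑-const : ∀ n c → ∑[ _ < n ] c ≡ + n * c
∑-const zero    c = refl
∑-const (suc n) c = trans (cong (_+ c) (∑-const n c)) (trans (step (+ n) c) (cong (_* c) (sym (+suc n))))
  where
  step : ∀ n c → n * c + c ≡ (n + 1ℤ) * c
  step = solve-∀

∑-affine : ∀ n c k → ∑[ x < n ] (c + k * + x) ≡ + n * c + k * ∑[ x < n ] (+ x)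
∑-affine n c k = trans (∑-distrib-+ n (λ _ → c) (λ x → k * + x)) (cong₂ _+_ (∑-const n c) (∑-*ˡ n k (λ x → + x)))

∑-comm : ∀ n m (h : ℕ → ℕ → ℤ) → ∑[ x < n ] (∑[ y < m ] h x y) ≡ ∑[ y < m ] (∑[ x < n ] h x y)
∑-comm zero    m h = sym (trans (∑-const m 0ℤ) (*-zeroʳ (+ m)))
∑-comm (suc n) m h = trans (cong (_+ ∑< m (h n)) (∑-comm n m h)) (sym (∑-distrib-+ m (λ y → ∑[ x < n ] h x y) (h n)))

∑-rotate : ∀ n (f : ℕ → ℤ) → ∑[ x < n ] f (suc x) + f 0 ≡ ∑< n f + f n
∑-rotate zero    f = refl
∑-rotate (suc n) f = trans (swap (∑[ x < n ] f (suc x)) (f (suc n)) (f 0)) (cong (_+ f (suc n)) (∑-rotate n f))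
  where
  swap : ∀ a b c → a + b + c ≡ a + c + b
  swap = solve-∀

∑-reverse : ∀ n (h : ℤ → ℤ) c → ∑[ x < n ] h (c - + x) ≡ ∑[ x < n ] h (c - + n + 1ℤ + + x)
∑-reverse zero    h c = refl
∑-reverse (suc n) h c = trans (cong (_+ h (c - + n)) (∑-reverse n h c))
  (trans (cong₂ _+_ (∑-cong n (λ x _ → cong h (shift c n x))) (cong h (first c n)))
         (∑-rotate n (λ x → h (c - + suc n + 1ℤ + + x))))
  where
  shift : ∀ c n x → c - + n + 1ℤ + + x ≡ c - + suc n + 1ℤ + + suc x
  shift c n x = trans (identity c (+ n) (+ x)) (sym (cong₂ (λ a b → c - a + 1ℤ + b) (+suc n) (+suc x)))
    where
    identity : ∀ c n x → c - n + 1ℤ + x ≡ c - (n + 1ℤ) + 1ℤ + (x + 1ℤ)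
    identity = solve-∀
  first : ∀ c n → c - + n ≡ c - + suc n + 1ℤ + + 0
  first c n = trans (identity c (+ n)) (sym (cong (λ a → c - a + 1ℤ + + 0) (+suc n)))
    where
    identity : ∀ c n → c - n ≡ c - (n + 1ℤ) + 1ℤ + 0ℤ
    identity = solve-∀

gauss-sum : ∀ n → ∑[ x < n ] (+ x) + ∑[ x < n ] (+ x) ≡ + n * (+ n - 1ℤ)
gauss-sum zero    = refl
gauss-sum (suc n) = trans (regroup (∑[ x < n ] (+ x)) (+ n))
  (trans (cong (_+ (+ n + + n)) (gauss-sum n)) (trans (step (+ n)) (cong (λ z → z * (z - 1ℤ)) (sym (+suc n)))))
  where
  regroup : ∀ a b → a + b + (a + b) ≡ a + a + (b + b)
  regroup = solve-∀
  step : ∀ n → n * (n - 1ℤ) + (n + n) ≡ (n + 1ℤ) * (n + 1ℤ - 1ℤ)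
  step = solve-∀

module _ (d : ℕ) .{{_ : ℕ.NonZero d}} where

  private
    window-slide : ∀ (h : ℤ → ℤ) c → ∑[ x < d ] h (c + 1ℤ + + x) + h c ≡ ∑[ x < d ] h (c + + x) + h (c + + d)
    window-slide h c = trans (cong₂ _+_ (∑-cong d (λ x _ → cong h (shift c x))) (cong h (sym (+-identityʳ c))))
                             (∑-rotate d (λ x → h (c + + x)))
      where
      shift : ∀ c x → c + 1ℤ + + x ≡ c + + suc x
      shift c x = trans (identity c (+ x)) (sym (cong (_+_ c) (+suc x)))
        where
        identity : ∀ c x → c + 1ℤ + x ≡ c + (x + 1ℤ)
        identity = solve-∀

  hermite-/ℕ : ∀ y → ∑[ x < d ] ((y + + x) /ℕ d) ≡ y
  hermite-/ℕ y = trans (constant-step⇒affine H 1ℤ step y) (trans (cong (_+ y * 1ℤ) H0) (trans (+-identityˡ _) (*-identityʳ y)))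
    where
    H : ℤ → ℤ
    H y = ∑[ x < d ] ((y + + x) /ℕ d)
    step : ∀ y → H (y + 1ℤ) ≡ H y + 1ℤ
    step y = +-cancelʳ _ _ (y /ℕ d) (trans (window-slide (_/ℕ d) y)
      (trans (cong (_+_ (H y)) (proj₁ (/ℕ-%ℕ-+d d y))) (assoc (H y) (y /ℕ d))))
      where
      assoc : ∀ a b → a + (b + 1ℤ) ≡ a + 1ℤ + b
      assoc = solve-∀
    H0 : H 0ℤ ≡ 0ℤ
    H0 = trans (∑-cong d (λ x x<d → trans (cong (_/ℕ d) (+-identityˡ (+ x))) (proj₁ (/ℕ-%ℕ-small d x x<d))))
               (trans (∑-const d 0ℤ) (*-zeroʳ (+ d)))

  ∑-periodic : (h : ℤ → ℤ) → (∀ y → h (y + + d) ≡ h y) → ∀ c → ∑[ x < d ] h (c + + x) ≡ ∑[ x < d ] h (+ x)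
  ∑-periodic h periodic c = trans (trans (constant-step⇒affine G 0ℤ step c) (drop (G 0ℤ) c))
                                  (∑-cong d (λ x _ → cong h (+-identityˡ (+ x))))
    where
    G : ℤ → ℤ
    G c = ∑[ x < d ] h (c + + x)
    step : ∀ c → G (c + 1ℤ) ≡ G c + 0ℤ
    step c = +-cancelʳ _ _ (h c) (trans (window-slide h c) (trans (cong (_+_ (G c)) (periodic c)) (assoc (G c) (h c))))
      where
      assoc : ∀ a b → a + b ≡ a + 0ℤ + b
      assoc = solve-∀
    drop : ∀ a c → a + c * 0ℤ ≡ a
    drop = solve-∀

  ∑-%ℕ-reversed : ∀ τ → ∑[ a < d ] (+ ((τ - + a) %ℕ d)) ≡ ∑[ a < d ] (+ a)
  ∑-%ℕ-reversed τ = trans (∑-reverse d residue τ) (trans (∑-periodic residue periodic (τ - + d + 1ℤ))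
    (∑-cong d (λ x x<d → cong +_ (proj₂ (/ℕ-%ℕ-small d x x<d)))))
    where
    residue : ℤ → ℤ
    residue y = + (y %ℕ d)
    periodic : ∀ y → residue (y + + d) ≡ residue y
    periodic y = cong +_ (proj₂ (/ℕ-%ℕ-+d d y))

-- Enumerations and cardinalities

concatUpTo : {A : Set} → (ℕ → List A) → ℕ → List A
concatUpTo g zero    = []
concatUpTo g (suc n) = concatUpTo g n ++ g n

module _ {A : Set} {g : ℕ → List A} {x : A} where

  ∈-concatUpTo⁻ : ∀ n → x ∈ concatUpTo g n → Σ ℕ λ k → (k ℕ.< n) × (x ∈ g k)
  ∈-concatUpTo⁻ (suc n) x∈ with ∈-++⁻ (concatUpTo g n) x∈
  ... | inj₂ x∈gn = n , ℕP.≤-refl , x∈gn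
  ... | inj₁ x∈ʳ with ∈-concatUpTo⁻ n x∈ʳ
  ...   | k , k<n , x∈gk = k , ℕP.m≤n⇒m≤1+n k<n , x∈gk

  ∈-concatUpTo⁺ : ∀ n k → k ℕ.< n → x ∈ g k → x ∈ concatUpTo g n
  ∈-concatUpTo⁺ (suc n) k k<1+n x∈gk with k ℕ.≟ n
  ... | yes refl = ∈-++⁺ʳ (concatUpTo g n) x∈gk
  ... | no  k≢n  = ∈-++⁺ˡ (∈-concatUpTo⁺ n k (ℕP.≤∧≢⇒< (ℕP.≤-pred k<1+n) k≢n) x∈gk)

length-concatUpTo : {A : Set} (g : ℕ → List A) → ∀ n → + length (concatUpTo g n) ≡ ∑[ k < n ] (+ length (g k))
length-concatUpTo g zero    = refl
length-concatUpTo g (suc n) = trans (cong +_ (length-++ (concatUpTo g n)))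
  (trans (pos-+ (length (concatUpTo g n)) (length (g n))) (cong (_+ + length (g n)) (length-concatUpTo g n)))

unique-concatUpTo : {A : Set} (g : ℕ → List A) (label : A → ℤ) → ∀ n →
  (∀ k x → k ℕ.< n → x ∈ g k → label x ≡ + k) → (∀ k → k ℕ.< n → Unique (g k)) → Unique (concatUpTo g n)
unique-concatUpTo g label zero    labelled unique = []
unique-concatUpTo g label (suc n) labelled unique =
  ++⁺ (unique-concatUpTo g label n (λ k x k<n → labelled k x (ℕP.m≤n⇒m≤1+n k<n)) (λ k k<n → unique k (ℕP.m≤n⇒m≤1+n k<n)))
      (unique n ℕP.≤-refl) disjoint
  where
  disjoint : ∀ {v} → ¬ (v ∈ concatUpTo g n × v ∈ g n)
  disjoint {v} (v∈ , v∈gn) with ∈-concatUpTo⁻ n v∈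
  ... | k , k<n , v∈gk =
    ℕP.<-irrefl (+-injective (trans (sym (labelled k v (ℕP.m≤n⇒m≤1+n k<n) v∈gk)) (labelled n v ℕP.≤-refl v∈gn))) k<n

range : ℤ → ℕ → List ℤ
range lo zero    = []
range lo (suc n) = lo ∷ range (lo + 1ℤ) n

length-range : ∀ lo n → length (range lo n) ≡ n
length-range lo zero    = refl
length-range lo (suc n) = cong suc (length-range (lo + 1ℤ) n)

private
  range-end : ∀ lo n → lo + 1ℤ + + n ≡ lo + + suc n
  range-end lo n = trans (identity lo (+ n)) (sym (cong (_+_ lo) (+suc n)))
    where
    identity : ∀ lo n → lo + 1ℤ + n ≡ lo + (n + 1ℤ)
    identity = solve-∀

∈-range⁻ : ∀ lo n {m} → m ∈ range lo n → (lo ≤ m) × (m < lo + + n)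
∈-range⁻ lo (suc n) (here refl) = ≤-refl , <-by-diff (0≤+ n) (trans (cong (λ z → z - lo - 1ℤ) (sym (range-end lo n))) (identity lo (+ n)))
  where
  identity : ∀ lo n → lo + 1ℤ + n - lo - 1ℤ ≡ n
  identity = solve-∀
∈-range⁻ lo (suc n) {m} (there m∈) with ∈-range⁻ (lo + 1ℤ) n m∈
... | lo+1≤m , m<end = <⇒≤ (suc[i]≤j⇒i<j (subst (_≤ m) (+-comm lo 1ℤ) lo+1≤m)) , subst (m <_) (range-end lo n) m<end

∈-range⁺ : ∀ lo n {m} → lo ≤ m → m < lo + + n → m ∈ range lo n
∈-range⁺ lo zero    {m} lo≤m m<lo = ⊥-elim (<-irrefl refl (≤-<-trans lo≤m (subst (m <_) (+-identityʳ lo) m<lo)))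
∈-range⁺ lo (suc n) {m} lo≤m m<end with m ≟ lo
... | yes refl = here refl
... | no  m≢lo = there (∈-range⁺ (lo + 1ℤ) n (subst (_≤ m) (+-comm 1ℤ lo) (i<j⇒suc[i]≤j (≤∧≢⇒< lo≤m (m≢lo ∘ sym))))
                                              (subst (m <_) (sym (range-end lo n)) m<end))

unique-range : ∀ lo n → Unique (range lo n)
unique-range lo zero    = []
unique-range lo (suc n) =
  tabulate (λ m∈ lo≡m → <-irrefl lo≡m (suc[i]≤j⇒i<j (subst (_≤ _) (+-comm lo 1ℤ) (proj₁ (∈-range⁻ (lo + 1ℤ) n m∈)))))
  ∷ unique-range (lo + 1ℤ) n

intervalSize : ℤ → ℤ → ℕ
intervalSize lo hi with hi - lo + 1ℤ
... | + n      = n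
... | -[1+ _ ] = 0

interval : ℤ → ℤ → List ℤ
interval lo hi = range lo (intervalSize lo hi)

intervalSize-nonempty : ∀ lo hi → 0ℤ ≤ hi - lo + 1ℤ → + intervalSize lo hi ≡ hi - lo + 1ℤ
intervalSize-nonempty lo hi 0≤ with hi - lo + 1ℤ
... | + n = refl

private
  interval-end : ∀ lo hi n → hi - lo + 1ℤ ≡ + n → lo + + n ≡ hi + 1ℤ
  interval-end lo hi n eq = trans (cong (_+_ lo) (sym eq)) (identity lo hi)
    where
    identity : ∀ lo hi → lo + (hi - lo + 1ℤ) ≡ hi + 1ℤ
    identity = solve-∀

∈-interval⁻ : ∀ lo hi {m} → m ∈ interval lo hi → (lo ≤ m) × (m ≤ hi)
∈-interval⁻ lo hi {m} m∈ with ∈-range⁻ lo _ m∈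
... | lo≤m , m<end with hi - lo + 1ℤ in eq
...   | + n      = lo≤m , <+1⇒≤ (subst (m <_) (interval-end lo hi n eq) m<end)
...   | -[1+ _ ] = ⊥-elim (<-irrefl refl (≤-<-trans lo≤m (subst (m <_) (+-identityʳ lo) m<end)))

∈-interval⁺ : ∀ lo hi {m} → lo ≤ m → m ≤ hi → m ∈ interval lo hi
∈-interval⁺ lo hi {m} lo≤m m≤hi = ∈-range⁺ lo _ lo≤m
  (subst (m <_) (sym (interval-end lo hi _ (sym (intervalSize-nonempty lo hi 0≤size)))) (≤-<-trans m≤hi (i<i+1 hi)))
  where
  i<i+1 : ∀ i → i < i + 1ℤ
  i<i+1 i = <-by-diff (0≤+ 0) (identity i)
    where
    identity : ∀ i → i + 1ℤ - i - 1ℤ ≡ 0ℤ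
    identity = solve-∀
  0≤size : 0ℤ ≤ hi - lo + 1ℤ
  0≤size = 0≤+0≤ (i≤j⇒0≤j-i (≤-trans lo≤m m≤hi)) (0≤+ 1)

unique-interval : ∀ lo hi → Unique (interval lo hi)
unique-interval lo hi = unique-range lo _

length-interval : ∀ lo hi → length (interval lo hi) ≡ intervalSize lo hi
length-interval lo hi = length-range lo _

HasCard-unique : {A : Set} {P : A → Set} {m n : ℕ} → HasCard P m → HasCard P n → m ≡ n
HasCard-unique (xs , unique-xs , xs⇔P , refl) (ys , unique-ys , ys⇔P , refl) =
  ↭-length (∼bag⇒↭ (unique∧set⇒bag unique-xs unique-ys (λ {x} →
    mk⇔ (λ x∈ → Equivalence.from (ys⇔P x) (Equivalence.to (xs⇔P x) x∈))
        (λ x∈ → Equivalence.from (xs⇔P x) (Equivalence.to (ys⇔P x) x∈)))))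

HasCard-insert : {A : Set} {P P' : A → Set} {n : ℕ} → HasCard P n → (x₀ : A) → ¬ P x₀ →
  (∀ x → P' x → x ≡ x₀ ⊎ P x) → P' x₀ → (∀ x → P x → P' x) → HasCard P' (suc n)
HasCard-insert {P = P} {P'} (xs , unique-xs , xs⇔P , length-xs) x₀ x₀∉P split P'x₀ P⊆P' =
  x₀ ∷ xs , tabulate (λ {y} y∈ y≡x₀ → x₀∉P (subst P (sym y≡x₀) (Equivalence.to (xs⇔P y) y∈))) ∷ unique-xs ,
  (λ x → mk⇔ (to x) (from x)) , cong suc length-xs
  where
  to : ∀ x → x ∈ x₀ ∷ xs → P' x
  to x (here refl) = P'x₀
  to x (there x∈)  = P⊆P' x (Equivalence.to (xs⇔P x) x∈)
  from : ∀ x → P' x → x ∈ x₀ ∷ xs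
  from x P'x with split x P'x
  ... | inj₁ x≡x₀ = here x≡x₀
  ... | inj₂ Px   = there (Equivalence.from (xs⇔P x) Px)

HasCard-involution : {A : Set} {P P' : A → Set} {n : ℕ} (f : A → A) → (∀ x → f (f x) ≡ x) →
  (∀ x → P x → P' (f x)) → (∀ x → P' x → P (f x)) → HasCard P n → HasCard P' n
HasCard-involution {P = P} {P'} f involutive P⇒P'∘f P'⇒P∘f (xs , unique-xs , xs⇔P , length-xs) =
  map f xs , map⁺ injective unique-xs , (λ x → mk⇔ (to x) (from x)) , trans (length-map f xs) length-xs
  where
  injective : ∀ {x y} → f x ≡ f y → x ≡ y
  injective {x} {y} fx≡fy = trans (sym (involutive x)) (trans (cong f fx≡fy) (involutive y))
  to : ∀ x → x ∈ map f xs → P' x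
  to x x∈ with ∈-map⁻ f x∈
  ... | y , y∈ , refl = P⇒P'∘f y (Equivalence.to (xs⇔P y) y∈)
  from : ∀ x → P' x → x ∈ map f xs
  from x P'x = subst (_∈ map f xs) (involutive x) (∈-map⁺ f (Equivalence.from (xs⇔P (f x)) (P'⇒P∘f x P'x)))

concatUpTo³ : {A : Set} → (ℕ → ℕ → ℕ → List A) → ℕ → ℕ → ℕ → List A
concatUpTo³ g n₁ n₂ n₃ = concatUpTo (λ a → concatUpTo (λ b → concatUpTo (g a b) n₃) n₂) n₁

module _ {A : Set} (g : ℕ → ℕ → ℕ → List A) (n₁ n₂ n₃ : ℕ) where

  InBlock : A → ℕ → ℕ → ℕ → Set
  InBlock x a b c = (a ℕ.< n₁) × (b ℕ.< n₂) × (c ℕ.< n₃) × (x ∈ g a b c)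

  ∈-concatUpTo³⁻ : ∀ {x} → x ∈ concatUpTo³ g n₁ n₂ n₃ → Σ ℕ λ a → Σ ℕ λ b → Σ ℕ λ c → InBlock x a b c
  ∈-concatUpTo³⁻ x∈ with ∈-concatUpTo⁻ n₁ x∈
  ... | a , a< , x∈₁ with ∈-concatUpTo⁻ n₂ x∈₁
  ...   | b , b< , x∈₂ with ∈-concatUpTo⁻ n₃ x∈₂
  ...     | c , c< , x∈₃ = a , b , c , a< , b< , c< , x∈₃

  ∈-concatUpTo³⁺ : ∀ {x a b c} → InBlock x a b c → x ∈ concatUpTo³ g n₁ n₂ n₃
  ∈-concatUpTo³⁺ {a = a} {b} {c} (a< , b< , c< , x∈) =
    ∈-concatUpTo⁺ n₁ a a< (∈-concatUpTo⁺ n₂ b b< (∈-concatUpTo⁺ n₃ c c< x∈))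

  length-concatUpTo³ : + length (concatUpTo³ g n₁ n₂ n₃) ≡ ∑[ a < n₁ ] (∑[ b < n₂ ] (∑[ c < n₃ ] (+ length (g a b c))))
  length-concatUpTo³ = trans (length-concatUpTo _ n₁) (∑-cong n₁ (λ a _ →
    trans (length-concatUpTo _ n₂) (∑-cong n₂ (λ b _ → length-concatUpTo (g a b) n₃))))

  unique-concatUpTo³ : (ℓ₁ ℓ₂ ℓ₃ : A → ℤ) →
    (∀ {x a b c} → InBlock x a b c → (ℓ₁ x ≡ + a) × (ℓ₂ x ≡ + b) × (ℓ₃ x ≡ + c)) →
    (∀ a b c → a ℕ.< n₁ → b ℕ.< n₂ → c ℕ.< n₃ → Unique (g a b c)) → Unique (concatUpTo³ g n₁ n₂ n₃)
  unique-concatUpTo³ ℓ₁ ℓ₂ ℓ₃ labelled unique =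
    unique-concatUpTo _ ℓ₁ n₁ label₁ λ a a< →
      unique-concatUpTo _ ℓ₂ n₂ (label₂ a< ) λ b b< →
        unique-concatUpTo (g a b) ℓ₃ n₃ (λ c x c< x∈ → proj₂ (proj₂ (labelled (a< , b< , c< , x∈)))) λ c c< →
          unique a b c a< b< c<
    where
    label₂ : ∀ {a} → a ℕ.< n₁ → ∀ b x → b ℕ.< n₂ → x ∈ concatUpTo (g a b) n₃ → ℓ₂ x ≡ + b
    label₂ a< b x b< x∈ with ∈-concatUpTo⁻ n₃ x∈
    ... | c , c< , x∈₃ = proj₁ (proj₂ (labelled (a< , b< , c< , x∈₃)))
    label₁ : ∀ a x → a ℕ.< n₁ → x ∈ concatUpTo (λ b → concatUpTo (g a b) n₃) n₂ → ℓ₁ x ≡ + a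
    label₁ a x a< x∈ with ∈-concatUpTo⁻ n₂ x∈
    ... | b , b< , x∈₂ with ∈-concatUpTo⁻ n₃ x∈₂
    ...   | c , c< , x∈₃ = proj₁ (labelled (a< , b< , c< , x∈₃))

module Lattice (q₀ : ℕ) where
  q q+1 Nℕ Pℕ : ℕ
  q   = suc q₀
  q+1 = suc q
  Nℕ  = q ℕ.* q ℕ.+ q
  Pℕ  = q ℕ.* Nℕ

  Q N P : ℤ
  Q = + q
  N = Q * Q + Q
  P = + Pℕ

  +Nℕ≡N : + Nℕ ≡ N
  +Nℕ≡N = trans (pos-+ (q ℕ.* q) q) (cong (_+ Q) (pos-* q q))

  P≡Q*N : P ≡ Q * N
  P≡Q*N = trans (pos-* q Nℕ) (cong (_*_ Q) +Nℕ≡N)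

  +q+1≡Q+1 : + q+1 ≡ Q + 1ℤ
  +q+1≡Q+1 = +suc q

  0≤Q+1 : 0ℤ ≤ Q + 1ℤ
  0≤Q+1 = subst (0ℤ ≤_) +q+1≡Q+1 (0≤+ q+1)

  0≤Q-1 : 0ℤ ≤ Q - 1ℤ
  0≤Q-1 = subst (0ℤ ≤_) (sym (trans (cong (_- 1ℤ) (+suc q₀)) (cancel (+ q₀)))) (0≤+ q₀)
    where
    cancel : ∀ a → a + 1ℤ - 1ℤ ≡ a
    cancel = solve-∀

  Point : Set
  Point = ℤ × ℤ × ℤ

  iₚ A B C : Point → ℤ
  iₚ (i , j , k) = i
  A  (i , j , k) = i + N * k
  B  (i , j , k) = Q * i + N * j + (Q + + 1) * k
  C  (i , j , k) = - (Q * Q) * i - (Q * Q * Q - Q) * j - (Q * Q * Q + Q * Q - Q - + 1) * k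

  C≡-i-[Q-1][A+B] : ∀ x → C x ≡ - iₚ x - (Q - 1ℤ) * (A x + B x)
  C≡-i-[Q-1][A+B] (i , j , k) = identity Q i j k
    where
    identity : ∀ Q i j k → - (Q * Q) * i - (Q * Q * Q - Q) * j - (Q * Q * Q + Q * Q - Q - + 1) * k
                         ≡ - i - (Q - 1ℤ) * ((i + (Q * Q + Q) * k) + (Q * i + (Q * Q + Q) * j + (Q + + 1) * k))
    identity = solve-∀

  InWindow : ℤ → ℤ → Set
  InWindow s a = (- s ≤ a) × (a < - s + N)

  InΩ : (r s t u : ℤ) → Point → Set
  InΩ r s t u x = (- r ≤ iₚ x) × InWindow s (A x) × InWindow t (B x) × (- u ≤ C x)

  Ω⇒InΩ : ∀ {r s t u} x → Ω Q r s t u x → InΩ r s t u x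
  Ω⇒InΩ (i , j , k) (r≤i , a₁ , a₂ , b₁ , b₂ , u≤C) = r≤i , (a₁ , a₂) , (b₁ , b₂) , u≤C

  InΩ⇒Ω : ∀ {r s t u} x → InΩ r s t u x → Ω Q r s t u x
  InΩ⇒Ω (i , j , k) (r≤i , (a₁ , a₂) , (b₁ , b₂) , u≤C) = r≤i , a₁ , a₂ , b₁ , b₂ , u≤C

  σ : Point → Point
  σ (i , j , k) = C (i , j , k) , (Q - 1ℤ) * i + (Q * Q - Q - 1ℤ) * j + (Q * Q - 1ℤ) * k , i + Q * j + Q * k

  module _ (i j k : ℤ) where

    A∘σ : A (σ (i , j , k)) ≡ B (i , j , k)
    A∘σ = identity Q i j k
      where
      identity : ∀ Q i j k → let i′ = - (Q * Q) * i - (Q * Q * Q - Q) * j - (Q * Q * Q + Q * Q - Q - + 1) * k in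
        i′ + (Q * Q + Q) * (i + Q * j + Q * k) ≡ Q * i + (Q * Q + Q) * j + (Q + + 1) * k
      identity = solve-∀

    B∘σ : B (σ (i , j , k)) ≡ A (i , j , k)
    B∘σ = identity Q i j k
      where
      identity : ∀ Q i j k → let i′ = - (Q * Q) * i - (Q * Q * Q - Q) * j - (Q * Q * Q + Q * Q - Q - + 1) * k
                                 j′ = (Q - 1ℤ) * i + (Q * Q - Q - 1ℤ) * j + (Q * Q - 1ℤ) * k in
        Q * i′ + (Q * Q + Q) * j′ + (Q + + 1) * (i + Q * j + Q * k) ≡ i + (Q * Q + Q) * k
      identity = solve-∀

    σ-involutive : σ (σ (i , j , k)) ≡ (i , j , k)
    σ-involutive = cong₂ _,_ (identityᵢ Q i j k) (cong₂ _,_ (identityⱼ Q i j k) (identityₖ Q i j k))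
      where
      identityᵢ : ∀ Q i j k → let i′ = - (Q * Q) * i - (Q * Q * Q - Q) * j - (Q * Q * Q + Q * Q - Q - + 1) * k
                                  j′ = (Q - 1ℤ) * i + (Q * Q - Q - 1ℤ) * j + (Q * Q - 1ℤ) * k
                                  k′ = i + Q * j + Q * k in
        - (Q * Q) * i′ - (Q * Q * Q - Q) * j′ - (Q * Q * Q + Q * Q - Q - + 1) * k′ ≡ i
      identityᵢ = solve-∀
      identityⱼ : ∀ Q i j k → let i′ = - (Q * Q) * i - (Q * Q * Q - Q) * j - (Q * Q * Q + Q * Q - Q - + 1) * k
                                  j′ = (Q - 1ℤ) * i + (Q * Q - Q - 1ℤ) * j + (Q * Q - 1ℤ) * k
                                  k′ = i + Q * j + Q * k in
        (Q - 1ℤ) * i′ + (Q * Q - Q - 1ℤ) * j′ + (Q * Q - 1ℤ) * k′ ≡ j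
      identityⱼ = solve-∀
      identityₖ : ∀ Q i j k → let i′ = - (Q * Q) * i - (Q * Q * Q - Q) * j - (Q * Q * Q + Q * Q - Q - + 1) * k
                                  j′ = (Q - 1ℤ) * i + (Q * Q - Q - 1ℤ) * j + (Q * Q - 1ℤ) * k
                                  k′ = i + Q * j + Q * k in
        i′ + Q * j′ + Q * k′ ≡ k
      identityₖ = solve-∀

  C∘σ : ∀ x → C (σ x) ≡ iₚ x
  C∘σ (i , j , k) = cong iₚ (σ-involutive i j k)

  InWindow⇒offset : ∀ {s a} → InWindow s a → Σ ℕ λ n → (n ℕ.< Nℕ) × (a + s ≡ + n)
  InWindow⇒offset {s} {a} (-s≤a , a<-s+N) = ∣ a + s ∣ , drop‿+<+ (subst₂ _<_ (sym +∣a+s∣≡a+s) (sym +Nℕ≡N) a+s<N) , sym +∣a+s∣≡a+s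
    where
    shift : a - - s ≡ a + s - 0ℤ
    shift = identity a s
      where
      identity : ∀ a s → a - - s ≡ a + s - 0ℤ
      identity = solve-∀
    +∣a+s∣≡a+s : + ∣ a + s ∣ ≡ a + s
    +∣a+s∣≡a+s = 0≤i⇒+∣i∣≡i (≤-respects-diff shift -s≤a)
    a+s<N : a + s < N
    a+s<N = <-respects-diff (identity a s N) a<-s+N
      where
      identity : ∀ a s N → - s + N - a ≡ N - (a + s)
      identity = solve-∀

  offset⇒InWindow : ∀ {s a} n → n ℕ.< Nℕ → a + s ≡ + n → InWindow s a
  offset⇒InWindow {s} {a} n n<Nℕ a+s≡n =
    ≤-by-diff (0≤+ n) (trans (identity₁ a s) a+s≡n) ,
    <-respects-diff (linear-combination₂ 1ℤ 1ℤ (identity₂ a s N (+ n) (+ Nℕ)) a+s≡n +Nℕ≡N) (+<+ n<Nℕ)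
    where
    identity₁ : ∀ a s → a - - s ≡ a + s
    identity₁ = solve-∀
    identity₂ : ∀ a s N n Nℕ → Nℕ - n ≡ - s + N - a + 1ℤ * ((a + s) - n) + 1ℤ * (Nℕ - N)
    identity₂ = solve-∀

  InWindow-unique : ∀ {s a a'} z → InWindow s a → InWindow s a' → a ≡ a' + z * N → z ≡ 0ℤ
  InWindow-unique {s} {a} {a'} z wa wa' a≡a'+zN with InWindow⇒offset wa | InWindow⇒offset wa'
  ... | n , n< , a+s≡n | n' , n'< , a'+s≡n' =
    trans (sym (proj₁ (/ℕ-%ℕ-unique Nℕ (a + s) n' z n'< via-a'))) (proj₁ (/ℕ-%ℕ-unique Nℕ (a + s) n 0ℤ n< via-a))
    where
    via-a : a + s ≡ + n + 0ℤ * + Nℕ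
    via-a = trans a+s≡n (sym (trans (cong (_+_ (+ n)) (*-zeroˡ (+ Nℕ))) (+-identityʳ (+ n))))
    via-a' : a + s ≡ + n' + z * + Nℕ
    via-a' = linear-combination₃ 1ℤ 1ℤ (- z) (identity a a' s z N (+ n') (+ Nℕ)) a≡a'+zN a'+s≡n' +Nℕ≡N
      where
      identity : ∀ a a' s z N n' Nℕ → a + s ≡ n' + z * Nℕ + 1ℤ * (a - (a' + z * N)) + 1ℤ * ((a' + s) - n') + (- z) * (Nℕ - N)
      identity = solve-∀

  InWindow-reduce : ∀ s a y → a + s ≡ y + N * - (y /ℕ Nℕ) → InWindow s a
  InWindow-reduce s a y eq = offset⇒InWindow (y %ℕ Nℕ) (n%ℕd<d y Nℕ)
    (trans eq (trans (linear-combination₁ (y /ℕ Nℕ) (identity y (y /ℕ Nℕ) N (+ Nℕ)) +Nℕ≡N) (-/ℕ*≡%ℕ Nℕ y)))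
    where
    identity : ∀ y f N Nℕ → y + N * - f ≡ y - f * Nℕ + f * (Nℕ - N)
    identity = solve-∀

  -- The unique point with given i whose A and B lie in the windows of s and t.
  kWithI : ℤ → ℤ → ℤ
  kWithI s i = - ((i + s) /ℕ Nℕ)

  pointWithI : ℤ → ℤ → ℤ → Point
  pointWithI s t i = i , - ((Q * i + (Q + + 1) * kWithI s i + t) /ℕ Nℕ) , kWithI s i

  module _ (s t i : ℤ) where

    pointWithI-A : InWindow s (A (pointWithI s t i))
    pointWithI-A = InWindow-reduce s _ (i + s) (identity i N ((i + s) /ℕ Nℕ) s)
      where
      identity : ∀ i N f s → i + N * - f + s ≡ i + s + N * - f
      identity = solve-∀

    pointWithI-B : InWindow t (B (pointWithI s t i))
    pointWithI-B = InWindow-reduce t _ y (identity Q i N (y /ℕ Nℕ) (kWithI s i) t)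
      where
      y = Q * i + (Q + + 1) * kWithI s i + t
      identity : ∀ Q i N f k t → Q * i + N * - f + (Q + + 1) * k + t ≡ Q * i + (Q + + 1) * k + t + N * - f
      identity = solve-∀

  windows-determine-point : ∀ {s t} x x' → InWindow s (A x) → InWindow t (B x) → InWindow s (A x') → InWindow t (B x') →
    iₚ x ≡ iₚ x' → x ≡ x'
  windows-determine-point (i , j , k) (i' , j' , k') wa wb wa' wb' i≡i' = cong₂ _,_ i≡i' (cong₂ _,_ j≡j' k≡k')
    where
    k≡k' : k ≡ k'
    k≡k' = i-j≡0⇒i≡j k k' (InWindow-unique (k - k') wa wa' (linear-combination₁ 1ℤ (identity i i' N k k') i≡i'))
      where
      identity : ∀ i i' N k k' → i + N * k ≡ i' + N * k' + (k - k') * N + 1ℤ * (i - i')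
      identity = solve-∀
    j≡j' : j ≡ j'
    j≡j' = i-j≡0⇒i≡j j j' (InWindow-unique (j - j') wb wb' (linear-combination₂ Q (Q + + 1) (identity Q i i' N j j' k k') i≡i' k≡k'))
      where
      identity : ∀ Q i i' N j j' k k' → Q * i + N * j + (Q + + 1) * k
               ≡ Q * i' + N * j' + (Q + + 1) * k' + (j - j') * N + Q * (i - i') + (Q + + 1) * (k - k')
      identity = solve-∀

  K : ℤ → ℤ → ℤ
  K s t = (Q - 1ℤ) * (N + N - (s + t))

  K-comm : ∀ s t → K s t ≡ K t s
  K-comm s t = identity Q N s t
    where
    identity : ∀ Q N s t → (Q - 1ℤ) * (N + N - (s + t)) ≡ (Q - 1ℤ) * (N + N - (t + s))
    identity = solve-∀

  windows⇒≤K : ∀ {s t a b} → InWindow s a → InWindow t b → (Q - 1ℤ) * (a + b) ≤ K s t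
  windows⇒≤K {s} {t} {a} {b} (_ , a<) (_ , b<) =
    ≤-by-diff (0≤* 0≤Q-1 (0≤+0≤ (0≤+0≤ (0≤+0≤ (<⇒0≤diff-1 a<) (<⇒0≤diff-1 b<)) (0≤+ 1)) (0≤+ 1))) (identity Q s t a b)
    where
    identity : ∀ Q s t a b → (Q - 1ℤ) * ((Q * Q + Q) + (Q * Q + Q) - (s + t)) - (Q - 1ℤ) * (a + b)
             ≡ (Q - 1ℤ) * ((- s + (Q * Q + Q) - a - 1ℤ) + (- t + (Q * Q + Q) - b - 1ℤ) + 1ℤ + 1ℤ)
    identity = solve-∀

  0≤C+i+K : ∀ {s t} x → InWindow s (A x) → InWindow t (B x) → 0ℤ ≤ C x + iₚ x + K s t
  0≤C+i+K {s} {t} x wa wb = subst (0ℤ ≤_)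
    (sym (linear-combination₁ 1ℤ (identity (C x) (iₚ x) (K s t) Q (A x) (B x)) (C≡-i-[Q-1][A+B] x)))
    (i≤j⇒0≤j-i (windows⇒≤K wa wb))
    where
    identity : ∀ C i K Q a b → C + i + K ≡ K - (Q - 1ℤ) * (a + b) + 1ℤ * (C - (- i - (Q - 1ℤ) * (a + b)))
    identity = solve-∀

  InΩ-σ : ∀ {r s t u} x → InΩ r s t u x → InΩ u t s r (σ x)
  InΩ-σ {r} (i , j , k) (r≤i , wa , wb , u≤C) =
    u≤C , subst (InWindow _) (sym (A∘σ i j k)) wb , subst (InWindow _) (sym (B∘σ i j k)) wa ,
    subst (- r ≤_) (sym (C∘σ (i , j , k))) r≤i

  InWindow-digits : ∀ s (α a : ℕ) → α ℕ.< q → a ℕ.< q+1 → InWindow s ((Q + + 1) * + α + + a - s)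
  InWindow-digits s α a α<q a<q+1 =
    ≤-by-diff (0≤+0≤ (0≤* 0≤Q+1 (0≤+ α)) (0≤+ a)) (identity₁ Q (+ α) (+ a) s) ,
    <-by-diff (0≤+0≤ (0≤* 0≤Q+1 (<⇒0≤diff-1 (+<+ α<q))) (<⇒0≤diff-1 (+<+ a<q+1)))
      (linear-combination₁ (- 1ℤ) (identity₂ Q (+ α) (+ a) s (+ q+1)) +q+1≡Q+1)
    where
    identity₁ : ∀ Q α a s → (Q + + 1) * α + a - s - - s ≡ (Q + + 1) * α + a
    identity₁ = solve-∀
    identity₂ : ∀ Q α a s q+1 → - s + (Q * Q + Q) - ((Q + + 1) * α + a - s) - 1ℤ
              ≡ (Q + + 1) * (Q - α - 1ℤ) + (q+1 - a - 1ℤ) + (- 1ℤ) * (q+1 - (Q + 1ℤ))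
    identity₂ = solve-∀

  digits-offset : ∀ s (α a : ℕ) → (Q + + 1) * + α + + a - s + s ≡ + a + + α * + q+1
  digits-offset s α a = linear-combination₁ (+ α) (identity Q (+ α) (+ a) s (+ q+1)) (sym +q+1≡Q+1)
    where
    identity : ∀ Q α a s q+1 → (Q + + 1) * α + a - s + s ≡ a + α * q+1 + α * ((Q + 1ℤ) - q+1)
    identity = solve-∀

  InWindow⇒digits : ∀ {s a} → InWindow s a → Σ ℕ λ α → (α ℕ.< q) × (a + s ≡ + ((a + s) %ℕ q+1) + + α * + q+1)
  InWindow⇒digits {s} {a} w with InWindow⇒offset w
  ... | n , n<Nℕ , a+s≡n = ∣ z /ℕ q+1 ∣ , drop‿+<+ α<Q ,
        trans (a≡a%ℕn+[a/ℕn]*n z q+1) (cong (λ f → + (z %ℕ q+1) + f * + q+1) (sym +α≡z/q+1))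
    where
    z = a + s
    +α≡z/q+1 : + ∣ z /ℕ q+1 ∣ ≡ z /ℕ q+1
    +α≡z/q+1 = 0≤i⇒+∣i∣≡i (*≤⇒≤/ℕ q+1 z 0ℤ (subst (_≤ z) (sym (*-zeroˡ (+ q+1))) (subst (0ℤ ≤_) (sym a+s≡n) (0≤+ n))))
    z<Q*q+1 : z < Q * + q+1
    z<Q*q+1 = subst₂ _<_ (sym a+s≡n) (trans +Nℕ≡N (identity Q (+ q+1) +q+1≡Q+1)) (+<+ n<Nℕ)
      where
      identity : ∀ Q q+1 → q+1 ≡ Q + 1ℤ → Q * Q + Q ≡ Q * q+1
      identity Q q+1 refl = lemma Q
        where
        lemma : ∀ Q → Q * Q + Q ≡ Q * (Q + 1ℤ)
        lemma = solve-∀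
    α<Q : + ∣ z /ℕ q+1 ∣ < Q
    α<Q = *-cancelʳ-<-nonNeg (+ q+1)
      (≤-<-trans (≤/ℕ⇒*≤ q+1 z _ (≤-reflexive +α≡z/q+1)) z<Q*q+1)

  ∑cells : (ℕ → ℕ → ℕ → ℤ) → ℤ
  ∑cells f = ∑[ a < q+1 ] (∑[ α < q ] (∑[ β < q ] (f a α β)))

  ∑cells-cong : ∀ {f g} → (∀ a α β → a ℕ.< q+1 → α ℕ.< q → β ℕ.< q → f a α β ≡ g a α β) → ∑cells f ≡ ∑cells g
  ∑cells-cong f≡g = ∑-cong q+1 (λ a a< → ∑-cong q (λ α α< → ∑-cong q (λ β β< → f≡g a α β a< α< β<)))

  ∑cells-distrib-+ : ∀ f g → ∑cells (λ a α β → f a α β + g a α β) ≡ ∑cells f + ∑cells g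
  ∑cells-distrib-+ f g = trans
    (∑-cong q+1 (λ a _ → trans (∑-cong q (λ α _ → ∑-distrib-+ q (f a α) (g a α)))
                               (∑-distrib-+ q (λ α → ∑< q (f a α)) (λ α → ∑< q (g a α)))))
    (∑-distrib-+ q+1 (λ a → ∑[ α < q ] (∑< q (f a α))) (λ a → ∑[ α < q ] (∑< q (g a α))))

  ∑cells-*ˡ : ∀ c f → ∑cells (λ a α β → c * f a α β) ≡ c * ∑cells f
  ∑cells-*ˡ c f = trans (∑-cong q+1 (λ a _ → trans (∑-cong q (λ α _ → ∑-*ˡ q c (f a α))) (∑-*ˡ q c (λ α → ∑< q (f a α)))))
                        (∑-*ˡ q+1 c (λ a → ∑[ α < q ] (∑< q (f a α))))

  ∑-∑cells-comm : ∀ n (h : ℕ → ℕ → ℕ → ℕ → ℤ) → ∑[ x < n ] (∑cells (h x)) ≡ ∑cells (λ a α β → ∑[ x < n ] (h x a α β))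
  ∑-∑cells-comm n h = trans (∑-comm n q+1 _) (∑-cong q+1 (λ a _ → trans (∑-comm n q _) (∑-cong q (λ α _ → ∑-comm n q _))))

  ∑cells-1 : ∑cells (λ _ _ _ → 1ℤ) ≡ P
  ∑cells-1 = trans (∑-cong q+1 (λ a _ → trans (∑-cong q (λ α _ → ∑-const q 1ℤ)) (∑-const q (Q * 1ℤ))))
    (trans (∑-const q+1 (Q * (Q * 1ℤ))) (trans (cong (_* (Q * (Q * 1ℤ))) +q+1≡Q+1) (trans (identity Q) (sym P≡Q*N))))
    where
    identity : ∀ Q → (Q + 1ℤ) * (Q * (Q * 1ℤ)) ≡ Q * (Q * Q + Q)
    identity = solve-∀

  module Cells (s t : ℤ) where

    τ : ℤ
    τ = t - Q * s

    -- Modulo q+1 we have q ≡ -1 and N ≡ 0, so B + t ≡ τ - (A + s): the residue a of A + s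
    -- determines the residue b a of B + t.
    b : ℕ → ℕ
    b a = (τ - + a) %ℕ q+1

    c : ℕ → ℤ
    c a = (τ - + a) /ℕ q+1

    b<q+1 : ∀ a → b a ℕ.< q+1
    b<q+1 a = n%ℕd<d (τ - + a) q+1

    A₀ : ℕ → ℕ → ℤ
    A₀ a α = (Q + + 1) * + α + + a - s

    B₀ : ℕ → ℕ → ℤ
    B₀ a β = (Q + + 1) * + β + + b a - t

    k₀ : ℕ → ℕ → ℤ
    k₀ a β = + β - + a - c a

    kₘ : ℕ → ℕ → ℤ → ℤ
    kₘ a β m = k₀ a β + Q * m

    i₀ : ℕ → ℕ → ℕ → ℤ
    i₀ a α β = A₀ a α - N * k₀ a β

    C₀ : ℕ → ℕ → ℕ → ℤ
    C₀ a α β = - i₀ a α β - (Q - 1ℤ) * (A₀ a α + B₀ a β)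

    -- The cell (a, α, β) holds the points with A + s = a + (q+1)α and B + t = b a + (q+1)β.
    point : ℕ → ℕ → ℕ → ℤ → Point
    point a α β m = A₀ a α - N * kₘ a β m , Q * kₘ a β m - + α - m , kₘ a β m

    module _ (a α β : ℕ) (m : ℤ) where

      A-point : A (point a α β m) ≡ A₀ a α
      A-point = identity (A₀ a α) N (kₘ a β m)
        where
        identity : ∀ a n k → a - n * k + n * k ≡ a
        identity = solve-∀

      B-point : B (point a α β m) ≡ B₀ a β
      B-point = linear-combination₂ 1ℤ (c a) (identity Q s t (+ α) (+ β) (+ a) (+ b a) (c a) (+ q+1) m)
        (a≡a%ℕn+[a/ℕn]*n (τ - + a) q+1) +q+1≡Q+1
        where
        identity : ∀ Q s t α β a b c q+1 m → let N = Q * Q + Q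
                                                 k = β - a - c + Q * m in
          Q * ((Q + + 1) * α + a - s - N * k) + N * (Q * k - α - m) + (Q + + 1) * k
            ≡ (Q + + 1) * β + b - t + 1ℤ * ((t - Q * s - a) - (b + c * q+1)) + c * (q+1 - (Q + 1ℤ))
        identity = solve-∀

      i-point : iₚ (point a α β m) ≡ i₀ a α β - P * m
      i-point = linear-combination₁ m (identity (A₀ a α) N (k₀ a β) Q m P) P≡Q*N
        where
        identity : ∀ a N k Q m P → a - N * (k + Q * m) ≡ a - N * k - P * m + m * (P - Q * N)
        identity = solve-∀

      C-point : C (point a α β m) ≡ C₀ a α β + P * m
      C-point = begin
        C x                                                  ≡⟨ C≡-i-[Q-1][A+B] x ⟩
        - iₚ x - (Q - 1ℤ) * (A x + B x)                      ≡⟨ cong₂ (λ i ab → - i - (Q - 1ℤ) * ab) i-point (cong₂ _+_ A-point B-point) ⟩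
        - (i₀ a α β - P * m) - (Q - 1ℤ) * (A₀ a α + B₀ a β)  ≡⟨ identity (i₀ a α β) P m Q (A₀ a α + B₀ a β) ⟩
        C₀ a α β + P * m                                     ∎
        where
        open ≡-Reasoning
        x = point a α β m
        identity : ∀ i P m Q ab → - (i - P * m) - (Q - 1ℤ) * ab ≡ - i - (Q - 1ℤ) * ab + P * m
        identity = solve-∀

      point-digits : a ℕ.< q+1 →
        ((A (point a α β m) + s) %ℕ q+1 ≡ a) × ((A (point a α β m) + s) /ℕ q+1 ≡ + α) × ((B (point a α β m) + t) /ℕ q+1 ≡ + β)
      point-digits a<q+1 = proj₂ A-digits , proj₁ A-digits , proj₁ B-digits
        where
        A-digits = /ℕ-%ℕ-unique q+1 _ a (+ α) a<q+1 (trans (cong (_+ s) A-point) (digits-offset s α a))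
        B-digits = /ℕ-%ℕ-unique q+1 _ (b a) (+ β) (b<q+1 a) (trans (cong (_+ t) B-point) (digits-offset t β (b a)))

    point-injective : ∀ a α β {m m'} → point a α β m ≡ point a α β m' → m ≡ m'
    point-injective a α β {m} {m'} eq = *-cancelˡ-≡ Q m m'
      (+-cancelʳ _ _ (k₀ a β) (trans (+-comm (Q * m) (k₀ a β)) (trans (cong (λ x → proj₂ (proj₂ x)) eq) (+-comm (k₀ a β) (Q * m')))))

    digits⇒point : ∀ i j k (α β : ℕ) → let a = (i + N * k + s) %ℕ q+1 in
      i + N * k + s ≡ + a + + α * + q+1 →
      Q * i + N * j + (Q + + 1) * k + t ≡ + ((Q * i + N * j + (Q + + 1) * k + t) %ℕ q+1) + + β * + q+1 →
      (i , j , k) ≡ point a α β (Q * k - j - + α)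
    digits⇒point i j k α β A+s≡ B+t≡digits = cong₂ _,_ i≡ (cong₂ _,_ j≡ (sym kₘ≡k))
      where
      a = (i + N * k + s) %ℕ q+1
      τ-a≡ = a≡a%ℕn+[a/ℕn]*n (τ - + a) q+1
      carry = i + Q * j + k + Q * k + s
      B-residue : (Q * i + N * j + (Q + + 1) * k + t) %ℕ q+1 ≡ b a
      B-residue = proj₂ (/ℕ-%ℕ-unique q+1 _ (b a) (c a + (carry - + α)) (b<q+1 a)
        (linear-combination₃ 1ℤ (- 1ℤ) (- carry) (identity Q i j k s t (+ a) (+ α) (+ b a) (c a) (+ q+1)) τ-a≡ A+s≡ +q+1≡Q+1))
        where
        identity : ∀ Q i j k s t a α b c q+1 → let N = Q * Q + Q
                                                   carry = i + Q * j + k + Q * k + s in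
          Q * i + N * j + (Q + + 1) * k + t ≡ b + (c + (carry - α)) * q+1
            + 1ℤ * ((t - Q * s - a) - (b + c * q+1)) + (- 1ℤ) * ((i + N * k + s) - (a + α * q+1))
            + (- carry) * (q+1 - (Q + 1ℤ))
        identity = solve-∀
      B+t≡ : Q * i + N * j + (Q + + 1) * k + t ≡ + b a + + β * + q+1
      B+t≡ = trans B+t≡digits (cong (λ r → + r + + β * + q+1) B-residue)
      m = Q * k - j - + α
      kₘ≡k : kₘ a β m ≡ k
      kₘ≡k = *-cancelˡ-≡ (+ q+1) _ _ (subst (λ w → w * kₘ a β m ≡ w * k) (sym +q+1≡Q+1)
        (linear-combination₄ Q (- 1ℤ) 1ℤ (Q * + α - + β + c a)
          (identity Q i j k s t (+ a) (+ α) (+ β) (+ b a) (c a) (+ q+1)) A+s≡ B+t≡ τ-a≡ +q+1≡Q+1))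
        where
        identity : ∀ Q i j k s t a α β b c q+1 → let N = Q * Q + Q in
          (Q + + 1) * (β - a - c + Q * (Q * k - j - α)) ≡ (Q + + 1) * k
            + Q * ((i + N * k + s) - (a + α * q+1)) + (- 1ℤ) * ((Q * i + N * j + (Q + + 1) * k + t) - (b + β * q+1))
            + 1ℤ * ((t - Q * s - a) - (b + c * q+1)) + (Q * α - β + c) * (q+1 - (Q + 1ℤ))
        identity = solve-∀
      i≡ : i ≡ A₀ a α - N * kₘ a β m
      i≡ = linear-combination₃ 1ℤ (+ α) N (identity Q i k s (+ a) (+ α) (+ q+1) (kₘ a β m)) A+s≡ +q+1≡Q+1 kₘ≡k
        where
        identity : ∀ Q i k s a α q+1 k' → let N = Q * Q + Q in
          i ≡ (Q + + 1) * α + a - s - N * k' + 1ℤ * ((i + N * k + s) - (a + α * q+1)) + α * (q+1 - (Q + 1ℤ)) + N * (k' - k)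
        identity = solve-∀
      j≡ : j ≡ Q * kₘ a β m - + α - m
      j≡ = linear-combination₁ (- Q) (identity Q j k (+ α) (kₘ a β m)) kₘ≡k
        where
        identity : ∀ Q j k α k' → j ≡ Q * k' - α - (Q * k - j - α) + (- Q) * (k' - k)
        identity = solve-∀

    cell-decomposition : ∀ x → InWindow s (A x) → InWindow t (B x) →
      Σ ℕ λ a → Σ ℕ λ α → Σ ℕ λ β → Σ ℤ λ m → (a ℕ.< q+1) × (α ℕ.< q) × (β ℕ.< q) × (x ≡ point a α β m)
    cell-decomposition (i , j , k) wa wb =
      let α , α<q , A+s≡ = InWindow⇒digits wa
          β , β<q , B+t≡ = InWindow⇒digits wb
      in _ , α , β , _ , n%ℕd<d (i + N * k + s) q+1 , α<q , β<q , digits⇒point i j k α β A+s≡ B+t≡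

  module Enumeration (s t r u : ℤ) where
    open Cells s t

    upper lower : ℕ → ℕ → ℕ → ℤ
    upper a α β = (i₀ a α β + r) /ℕ Pℕ
    lower a α β = - ((C₀ a α β + u) /ℕ Pℕ)

    module _ (a α β : ℕ) (m : ℤ) where

      -r≤i⇔≤upper : (- r ≤ iₚ (point a α β m)) ⇔ (m ≤ upper a α β)
      -r≤i⇔≤upper = mk⇔ (λ -r≤i → from floor⇔ (≤-respects-diff diff -r≤i))
                        (λ m≤upper → ≤-respects-diff (sym diff) (to floor⇔ m≤upper))
        where
        open Equivalence
        floor⇔ = ≤/ℕ⇔*≤ Pℕ (i₀ a α β + r) m
        identity : ∀ i P m r → i - P * m - - r ≡ i + r - m * P
        identity = solve-∀
        diff : iₚ (point a α β m) - - r ≡ i₀ a α β + r - m * P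
        diff = trans (cong (λ i → i - - r) (i-point a α β m)) (identity (i₀ a α β) P m r)

      -u≤C⇔lower≤ : (- u ≤ C (point a α β m)) ⇔ (lower a α β ≤ m)
      -u≤C⇔lower≤ = mk⇔ (λ -u≤C → to -≤⇔-≤ (from floor⇔ (≤-respects-diff diff -u≤C)))
                        (λ lower≤m → ≤-respects-diff (sym diff) (to floor⇔ (from -≤⇔-≤ lower≤m)))
        where
        open Equivalence
        floor⇔ = ≤/ℕ⇔*≤ Pℕ (C₀ a α β + u) (- m)
        identity : ∀ C P m u → C + P * m - - u ≡ C + u - (- m) * P
        identity = solve-∀
        diff : C (point a α β m) - - u ≡ C₀ a α β + u - (- m) * P
        diff = trans (cong (λ c → c - - u) (C-point a α β m)) (identity (C₀ a α β) P m u)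

    cellPoints : ℕ → ℕ → ℕ → List Point
    cellPoints a α β = map (point a α β) (interval (lower a α β) (upper a α β))

    ΩList : List Point
    ΩList = concatUpTo³ cellPoints q+1 q q

    point∈Ω : ∀ a α β m → a ℕ.< q+1 → α ℕ.< q → β ℕ.< q → m ∈ interval (lower a α β) (upper a α β) →
      Ω Q r s t u (point a α β m)
    point∈Ω a α β m a< α< β< m∈ =
      let lower≤m , m≤upper = ∈-interval⁻ (lower a α β) (upper a α β) m∈
      in InΩ⇒Ω (point a α β m)
        ( Equivalence.from (-r≤i⇔≤upper a α β m) m≤upper
        , subst (InWindow s) (sym (A-point a α β m)) (InWindow-digits s α a α< a<)
        , subst (InWindow t) (sym (B-point a α β m)) (InWindow-digits t β (b a) β< (b<q+1 a))
        , Equivalence.from (-u≤C⇔lower≤ a α β m) lower≤m )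

    ∈ΩList⇒Ω : ∀ x → x ∈ ΩList → Ω Q r s t u x
    ∈ΩList⇒Ω x x∈ =
      let a , α , β , a< , α< , β< , x∈cell = ∈-concatUpTo³⁻ cellPoints q+1 q q x∈
          m , m∈ , x≡point = ∈-map⁻ (point a α β) x∈cell
      in subst (Ω Q r s t u) (sym x≡point) (point∈Ω a α β m a< α< β< m∈)

    Ω⇒∈ΩList : ∀ x → Ω Q r s t u x → x ∈ ΩList
    Ω⇒∈ΩList x ω =
      let -r≤i , wa , wb , -u≤C = Ω⇒InΩ x ω
          a , α , β , m , a< , α< , β< , x≡point = cell-decomposition x wa wb
          lower≤m = Equivalence.to (-u≤C⇔lower≤ a α β m) (subst (λ y → - u ≤ C y) x≡point -u≤C)
          m≤upper = Equivalence.to (-r≤i⇔≤upper a α β m) (subst (λ y → - r ≤ iₚ y) x≡point -r≤i)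
      in subst (_∈ ΩList) (sym x≡point)
           (∈-concatUpTo³⁺ cellPoints q+1 q q
             (a< , α< , β< , ∈-map⁺ (point a α β) (∈-interval⁺ (lower a α β) (upper a α β) lower≤m m≤upper)))

    unique-ΩList : Unique ΩList
    unique-ΩList = unique-concatUpTo³ cellPoints q+1 q q
      (λ x → + ((A x + s) %ℕ q+1)) (λ x → (A x + s) /ℕ q+1) (λ x → (B x + t) /ℕ q+1) labelled
      (λ a α β _ _ _ → map⁺ (point-injective a α β) (unique-interval (lower a α β) (upper a α β)))
      where
      labelled : ∀ {x a α β} → InBlock cellPoints q+1 q q x a α β →
        (+ ((A x + s) %ℕ q+1) ≡ + a) × ((A x + s) /ℕ q+1 ≡ + α) × ((B x + t) /ℕ q+1 ≡ + β)
      labelled {x} {a} {α} {β} (a< , _ , _ , x∈) =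
        let m , _ , x≡point = ∈-map⁻ (point a α β) x∈
            a-digit , α-digit , β-digit = point-digits a α β m a<
        in trans (cong (λ y → + ((A y + s) %ℕ q+1)) x≡point) (cong +_ a-digit) ,
           trans (cong (λ y → (A y + s) /ℕ q+1) x≡point) α-digit ,
           trans (cong (λ y → (B y + t) /ℕ q+1) x≡point) β-digit

    ΩList-card : HasCard (Ω Q r s t u) (length ΩList)
    ΩList-card = ΩList , unique-ΩList , (λ x → mk⇔ (∈ΩList⇒Ω x) (Ω⇒∈ΩList x)) , refl

    length-ΩList : + length ΩList ≡ ∑cells (λ a α β → + intervalSize (lower a α β) (upper a α β))
    length-ΩList = trans (length-concatUpTo³ cellPoints q+1 q q)
      (∑cells-cong (λ a α β _ _ _ → cong +_ (trans (length-map (point a α β) (interval (lower a α β) (upper a α β)))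
                                                    (length-interval (lower a α β) (upper a α β)))))

  count : (r s t u : ℤ) → ℕ
  count r s t u = length (Enumeration.ΩList s t r u)

  count-card : ∀ r s t u → HasCard (Ω Q r s t u) (count r s t u)
  count-card r s t u = Enumeration.ΩList-card s t r u

  count-symmetric : ∀ r s t u → count u t s r ≡ count r s t u
  count-symmetric r s t u = HasCard-unique (count-card u t s r)
    (HasCard-involution σ (λ (i , j , k) → σ-involutive i j k)
      (λ x ω → InΩ⇒Ω (σ x) (InΩ-σ x (Ω⇒InΩ x ω))) (λ x ω → InΩ⇒Ω (σ x) (InΩ-σ x (Ω⇒InΩ x ω)))
      (count-card r s t u))

  -[r+1]<-r : ∀ r → - (r + 1ℤ) < - r
  -[r+1]<-r r = <-by-diff (0≤+ 0) (identity r)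
    where
    identity : ∀ r → - r - - (r + 1ℤ) - 1ℤ ≡ 0ℤ
    identity = solve-∀

  -- Raising r by one adds exactly the point with i = -(r+1) and A, B in their windows.
  count-step-r : ∀ r s t u → K s t ≤ r + u → count (r + 1ℤ) s t u ≡ suc (count r s t u)
  count-step-r r s t u K≤r+u =
    HasCard-unique (count-card (r + 1ℤ) s t u) (HasCard-insert (count-card r s t u) p p∉Ωᵣ split p∈Ωᵣ₊₁ widen)
    where
    c = - (r + 1ℤ)
    p = pointWithI s t c
    wa = pointWithI-A s t c
    wb = pointWithI-B s t c
    p∈Ωᵣ₊₁ : Ω Q (r + 1ℤ) s t u p
    p∈Ωᵣ₊₁ = InΩ⇒Ω p (≤-refl , wa , wb ,
      ≤-by-diff (0≤+0≤ (0≤+0≤ (0≤C+i+K p wa wb) (i≤j⇒0≤j-i K≤r+u)) (0≤+ 1)) (identity (C p) r u (K s t)))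
      where
      identity : ∀ C r u K → C - - u ≡ C + - (r + 1ℤ) + K + (r + u - K) + 1ℤ
      identity = solve-∀
    p∉Ωᵣ : ¬ Ω Q r s t u p
    p∉Ωᵣ ω = <-irrefl refl (≤-<-trans (proj₁ (Ω⇒InΩ p ω)) (-[r+1]<-r r))
    split : ∀ x → Ω Q (r + 1ℤ) s t u x → x ≡ p ⊎ Ω Q r s t u x
    split x ω = by-cases (iₚ x ≟ c)
      where
      identity : ∀ r → 1ℤ + - (r + 1ℤ) ≡ - r
      identity = solve-∀
      by-cases : Dec (iₚ x ≡ c) → x ≡ p ⊎ Ω Q r s t u x
      by-cases (yes i≡c) = let _ , wa′ , wb′ , _ = Ω⇒InΩ x ω in inj₁ (windows-determine-point x p wa′ wb′ wa wb i≡c)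
      by-cases (no i≢c)  = let c≤i , wa′ , wb′ , -u≤C = Ω⇒InΩ x ω in
        inj₂ (InΩ⇒Ω x (subst (_≤ iₚ x) (identity r) (i<j⇒suc[i]≤j (≤∧≢⇒< c≤i (i≢c ∘ sym))) , wa′ , wb′ , -u≤C))
    widen : ∀ x → Ω Q r s t u x → Ω Q (r + 1ℤ) s t u x
    widen x ω = let -r≤i , rest = Ω⇒InΩ x ω in InΩ⇒Ω x (≤-trans (<⇒≤ (-[r+1]<-r r)) -r≤i , rest)

  count-step-u : ∀ r s t u → K s t ≤ r + u → count r s t (u + 1ℤ) ≡ suc (count r s t u)
  count-step-u r s t u K≤r+u = begin
    count r s t (u + 1ℤ)  ≡⟨ count-symmetric r s t (u + 1ℤ) ⟨
    count (u + 1ℤ) t s r  ≡⟨ count-step-r u t s r (subst₂ _≤_ (K-comm s t) (+-comm r u) K≤r+u) ⟩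
    suc (count u t s r)   ≡⟨ cong suc (count-symmetric r s t u) ⟩
    suc (count r s t u)   ∎
    where open ≡-Reasoning

  average : (f : ℕ → ℕ → ℕ → ℤ) → let F = λ y → ∑cells (λ a α β → (f a α β + y) /ℕ Pℕ) in
    (∀ y → F y ≡ F 0ℤ + y * 1ℤ) → P * F 0ℤ + ∑[ x < Pℕ ] (+ x) ≡ ∑cells f
  average f affine = begin
    P * F 0ℤ + ∑[ x < Pℕ ] (+ x)                            ≡⟨ cong (_+_ (P * F 0ℤ)) (*-identityˡ _) ⟨
    P * F 0ℤ + 1ℤ * ∑[ x < Pℕ ] (+ x)                       ≡⟨ ∑-affine Pℕ (F 0ℤ) 1ℤ ⟨
    ∑[ x < Pℕ ] (F 0ℤ + 1ℤ * + x)                            ≡⟨ ∑-cong Pℕ (λ x _ → affine-at x) ⟩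
    ∑[ x < Pℕ ] (F (+ x))                                    ≡⟨ ∑-∑cells-comm Pℕ (λ x a α β → (f a α β + + x) /ℕ Pℕ) ⟩
    ∑cells (λ a α β → ∑[ x < Pℕ ] ((f a α β + + x) /ℕ Pℕ))  ≡⟨ ∑cells-cong (λ a α β _ _ _ → hermite-/ℕ Pℕ (f a α β)) ⟩
    ∑cells f                                                 ∎
    where
    open ≡-Reasoning
    F : ℤ → ℤ
    F y = ∑cells (λ a α β → (f a α β + y) /ℕ Pℕ)
    affine-at : ∀ x → F 0ℤ + 1ℤ * + x ≡ F (+ x)
    affine-at x = trans (cong (_+_ (F 0ℤ)) (*-comm 1ℤ (+ x))) (sym (affine (+ x)))

  module Formula (s t : ℤ) where
    open Cells s t

    T S : ℤ → ℤ
    T r = ∑cells (λ a α β → (i₀ a α β + r) /ℕ Pℕ)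
    S u = ∑cells (λ a α β → (C₀ a α β + u) /ℕ Pℕ)

    -- For r + u ≥ K no cell size ⌊(i₀+r)/P⌋ + ⌊(C₀+u)/P⌋ + 1 is negative, so intervalSize is exact.
    count≡T+S+P : ∀ r u → K s t ≤ r + u → + count r s t u ≡ T r + S u + P
    count≡T+S+P r u K≤r+u = begin
      + count r s t u                                                  ≡⟨ length-ΩList ⟩
      ∑cells (λ a α β → + intervalSize (lower a α β) (upper a α β))   ≡⟨ ∑cells-cong cell-size ⟩
      ∑cells (λ a α β → fᵢ a α β + f꜀ a α β + 1ℤ)                      ≡⟨ ∑cells-distrib-+ (λ a α β → fᵢ a α β + f꜀ a α β) (λ _ _ _ → 1ℤ) ⟩
      ∑cells (λ a α β → fᵢ a α β + f꜀ a α β) + ∑cells (λ _ _ _ → 1ℤ)   ≡⟨ cong₂ _+_ (∑cells-distrib-+ fᵢ f꜀) ∑cells-1 ⟩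
      T r + S u + P                                                    ∎
      where
      open ≡-Reasoning
      open Enumeration s t r u
      fᵢ f꜀ : ℕ → ℕ → ℕ → ℤ
      fᵢ a α β = (i₀ a α β + r) /ℕ Pℕ
      f꜀ a α β = (C₀ a α β + u) /ℕ Pℕ
      cell-size : ∀ a α β → a ℕ.< q+1 → α ℕ.< q → β ℕ.< q →
        + intervalSize (lower a α β) (upper a α β) ≡ fᵢ a α β + f꜀ a α β + 1ℤ
      cell-size a α β a< α< β< = trans (intervalSize-nonempty (lower a α β) (upper a α β) (subst (0ℤ ≤_) (sym size≡) 0≤size)) size≡
        where
        identity₁ : ∀ h f → h - - f + 1ℤ ≡ h + f + 1ℤ
        identity₁ = solve-∀
        size≡ : upper a α β - lower a α β + 1ℤ ≡ fᵢ a α β + f꜀ a α β + 1ℤ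
        size≡ = identity₁ (fᵢ a α β) (f꜀ a α β)
        identity₂ : ∀ i A B r u K Q → i + r + (- i - (Q - 1ℤ) * (A + B) + u) ≡ (K - (Q - 1ℤ) * (A + B)) + (r + u - K)
        identity₂ = solve-∀
        0≤size : 0ℤ ≤ fᵢ a α β + f꜀ a α β + 1ℤ
        0≤size = 0≤+⇒0≤/ℕ+/ℕ+1 Pℕ (i₀ a α β + r) (C₀ a α β + u) (subst (0ℤ ≤_)
          (sym (identity₂ (i₀ a α β) (A₀ a α) (B₀ a β) r u (K s t) Q))
          (0≤+0≤ (i≤j⇒0≤j-i (windows⇒≤K (InWindow-digits s α a α< a<) (InWindow-digits t β (b a) β< (b<q+1 a))))
                 (i≤j⇒0≤j-i K≤r+u)))

    private
      cancel-middle : ∀ a b x y → a + x + y ≡ b + x + y + 1ℤ → a ≡ b + 1ℤ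
      cancel-middle a b x y eq = trans (sym (identity₁ a x y)) (trans (cong (λ z → z - x - y) eq) (identity₂ b x y))
        where
        identity₁ : ∀ a x y → a + x + y - x - y ≡ a
        identity₁ = solve-∀
        identity₂ : ∀ b x y → b + x + y + 1ℤ - x - y ≡ b + 1ℤ
        identity₂ = solve-∀

      ≤-refl-+ : ∀ r K → K ≤ r + (K - r)
      ≤-refl-+ r K = ≤-reflexive (identity r K)
        where
        identity : ∀ r K → K ≡ r + (K - r)
        identity = solve-∀

      ≤-step-+ : ∀ r K → K ≤ r + 1ℤ + (K - r)
      ≤-step-+ r K = ≤-by-diff (0≤+ 1) (identity r K)
        where
        identity : ∀ r K → r + 1ℤ + (K - r) - K ≡ 1ℤ
        identity = solve-∀

    T-step : ∀ r → T (r + 1ℤ) ≡ T r + 1ℤ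
    T-step r = cancel-middle (T (r + 1ℤ)) (T r) (S u) P (begin
      T (r + 1ℤ) + S u + P    ≡⟨ count≡T+S+P (r + 1ℤ) u (≤-step-+ r (K s t)) ⟨
      + count (r + 1ℤ) s t u  ≡⟨ cong +_ (count-step-r r s t u (≤-refl-+ r (K s t))) ⟩
      + suc (count r s t u)   ≡⟨ +suc (count r s t u) ⟩
      + count r s t u + 1ℤ    ≡⟨ cong (_+ 1ℤ) (count≡T+S+P r u (≤-refl-+ r (K s t))) ⟩
      T r + S u + P + 1ℤ      ∎)
      where
      open ≡-Reasoning
      u = K s t - r

    S-step : ∀ u → S (u + 1ℤ) ≡ S u + 1ℤ
    S-step u = cancel-middle (S (u + 1ℤ)) (S u) (T r) P (begin
      S (u + 1ℤ) + T r + P    ≡⟨ swap (S (u + 1ℤ)) (T r) P ⟩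
      T r + S (u + 1ℤ) + P    ≡⟨ count≡T+S+P r (u + 1ℤ) K≤r+u+1 ⟨
      + count r s t (u + 1ℤ)  ≡⟨ cong +_ (count-step-u r s t u K≤r+u) ⟩
      + suc (count r s t u)   ≡⟨ +suc (count r s t u) ⟩
      + count r s t u + 1ℤ    ≡⟨ cong (_+ 1ℤ) (trans (count≡T+S+P r u K≤r+u) (swap (T r) (S u) P)) ⟩
      S u + T r + P + 1ℤ      ∎)
      where
      open ≡-Reasoning
      r = K s t - u
      swap : ∀ a b c → a + b + c ≡ b + a + c
      swap = solve-∀
      K≤r+u : K s t ≤ r + u
      K≤r+u = subst (K s t ≤_) (+-comm u r) (≤-refl-+ u (K s t))
      K≤r+u+1 : K s t ≤ r + (u + 1ℤ)
      K≤r+u+1 = subst (K s t ≤_) (identity u r) (≤-step-+ u (K s t))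
        where
        identity : ∀ u r → u + 1ℤ + r ≡ r + (u + 1ℤ)
        identity = solve-∀

    T-affine : ∀ r → T r ≡ T 0ℤ + r * 1ℤ
    T-affine = constant-step⇒affine T 1ℤ T-step

    S-affine : ∀ u → S u ≡ S 0ℤ + u * 1ℤ
    S-affine = constant-step⇒affine S 1ℤ S-step

    ∑cells-A₀+B₀ : ∑cells (λ a α β → A₀ a α + B₀ a β) ≡ P * (N - 1ℤ - s - t)
    ∑cells-A₀+B₀ = begin
      ∑cells (λ a α β → A₀ a α + B₀ a β)                      ≡⟨ ∑-cong q+1 (λ a _ → ∑-cong q (λ α _ → sum-over-β a α)) ⟩
      ∑[ a < q+1 ] (∑[ α < q ] (c₂ a + Q * (Q + + 1) * + α))  ≡⟨ ∑-cong q+1 (λ a _ → sum-over-α a) ⟩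
      ∑[ a < q+1 ] (c₃ + Q * Q * (+ a + + b a))                ≡⟨ sum-over-a ⟩
      + q+1 * c₃ + Q * Q * (SB + SB)                           ≡⟨ closed-form ⟩
      P * (N - 1ℤ - s - t)                                     ∎
      where
      open ≡-Reasoning
      SA SB c₃ : ℤ
      SA = ∑[ α < q ] (+ α)
      SB = ∑[ a < q+1 ] (+ a)
      c₃ = Q * (Q + + 1) * SA + Q * (Q + + 1) * SA - Q * Q * (s + t)
      c₁ : ℕ → ℕ → ℤ
      c₁ a α = (Q + + 1) * + α + + a - s + + b a - t
      c₂ : ℕ → ℤ
      c₂ a = Q * (+ a - s + + b a - t) + (Q + + 1) * SA
      sum-over-β : ∀ a α → ∑[ β < q ] (A₀ a α + B₀ a β) ≡ c₂ a + Q * (Q + + 1) * + α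
      sum-over-β a α = trans (∑-cong q (λ β _ → identity₁ Q (+ α) (+ a) s (+ b a) t (+ β)))
        (trans (∑-affine q (c₁ a α) (Q + + 1)) (identity₂ Q (+ α) (+ a) s (+ b a) t SA))
        where
        identity₁ : ∀ Q α a s b t β → ((Q + + 1) * α + a - s) + ((Q + + 1) * β + b - t) ≡ ((Q + + 1) * α + a - s + b - t) + (Q + + 1) * β
        identity₁ = solve-∀
        identity₂ : ∀ Q α a s b t SA → Q * ((Q + + 1) * α + a - s + b - t) + (Q + + 1) * SA
                                      ≡ (Q * (a - s + b - t) + (Q + + 1) * SA) + Q * (Q + + 1) * α
        identity₂ = solve-∀
      sum-over-α : ∀ a → ∑[ α < q ] (c₂ a + Q * (Q + + 1) * + α) ≡ c₃ + Q * Q * (+ a + + b a)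
      sum-over-α a = trans (∑-affine q (c₂ a) (Q * (Q + + 1))) (identity Q (+ a) s (+ b a) t SA)
        where
        identity : ∀ Q a s b t SA → Q * (Q * (a - s + b - t) + (Q + + 1) * SA) + Q * (Q + + 1) * SA
                 ≡ (Q * (Q + + 1) * SA + Q * (Q + + 1) * SA - Q * Q * (s + t)) + Q * Q * (a + b)
        identity = solve-∀
      sum-over-a : ∑[ a < q+1 ] (c₃ + Q * Q * (+ a + + b a)) ≡ + q+1 * c₃ + Q * Q * (SB + SB)
      sum-over-a = trans (∑-distrib-+ q+1 (λ _ → c₃) (λ a → Q * Q * (+ a + + b a))) (cong₂ _+_ (∑-const q+1 c₃)
        (trans (∑-*ˡ q+1 (Q * Q) (λ a → + a + + b a))
          (cong (_*_ (Q * Q)) (trans (∑-distrib-+ q+1 (λ a → + a) (λ a → + b a)) (cong (_+_ SB) (∑-%ℕ-reversed q+1 τ))))))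
      closed-form : + q+1 * c₃ + Q * Q * (SB + SB) ≡ P * (N - 1ℤ - s - t)
      closed-form = trans (cong (λ z → z * c₃ + Q * Q * (SB + SB)) +q+1≡Q+1)
        (linear-combination₃ ((Q + 1ℤ) * (Q * (Q + + 1))) (Q * Q) (- (N - 1ℤ - s - t)) (identity Q SA SB P s t)
          (gauss-sum q) (trans (gauss-sum q+1) (cong (λ z → z * (z - 1ℤ)) +q+1≡Q+1)) P≡Q*N)
        where
        identity : ∀ Q SA SB P s t → let N = Q * Q + Q in
          (Q + 1ℤ) * (Q * (Q + + 1) * SA + Q * (Q + + 1) * SA - Q * Q * (s + t)) + Q * Q * (SB + SB)
            ≡ P * (N - 1ℤ - s - t) + ((Q + 1ℤ) * (Q * (Q + + 1))) * ((SA + SA) - Q * (Q - 1ℤ))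
              + (Q * Q) * ((SB + SB) - (Q + 1ℤ) * (Q + 1ℤ - 1ℤ)) + (- (N - 1ℤ - s - t)) * (P - Q * N)
        identity = solve-∀

    ∑cells-i₀+C₀ : ∑cells i₀ + ∑cells C₀ ≡ - (Q - 1ℤ) * (P * (N - 1ℤ - s - t))
    ∑cells-i₀+C₀ = trans (sym (∑cells-distrib-+ i₀ C₀))
      (trans (∑cells-cong (λ a α β _ _ _ → identity (i₀ a α β) Q (A₀ a α) (B₀ a β)))
        (trans (∑cells-*ˡ (- (Q - 1ℤ)) (λ a α β → A₀ a α + B₀ a β)) (cong (_*_ (- (Q - 1ℤ))) ∑cells-A₀+B₀)))
      where
      identity : ∀ i Q A B → i + (- i - (Q - 1ℤ) * (A + B)) ≡ - (Q - 1ℤ) * (A + B)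
      identity = solve-∀

    T0+S0+P : T 0ℤ + S 0ℤ + P ≡ 1ℤ - g3 Q + (Q - 1ℤ) * s + (Q - 1ℤ) * t
    T0+S0+P = *-cancelˡ-≡ P _ _ (linear-combination₄ 1ℤ 1ℤ 1ℤ (- 1ℤ)
      (identity (T 0ℤ) (S 0ℤ) P (∑[ x < Pℕ ] (+ x)) (∑cells i₀) (∑cells C₀) Q s t)
      (average i₀ T-affine) (average C₀ S-affine) ∑cells-i₀+C₀ (gauss-sum Pℕ))
      where
      identity : ∀ T0 S0 P X Σi ΣC Q s t → let N = Q * Q + Q in
        P * (T0 + S0 + P) ≡ P * (1ℤ - (Q * Q * Q - + 2 * Q + + 1) + (Q - 1ℤ) * s + (Q - 1ℤ) * t)
          + 1ℤ * ((P * T0 + X) - Σi) + 1ℤ * ((P * S0 + X) - ΣC)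
          + 1ℤ * ((Σi + ΣC) - (- (Q - 1ℤ) * (P * (N - 1ℤ - s - t)))) + (- 1ℤ) * ((X + X) - P * (P - 1ℤ))
      identity = solve-∀

    count-formula : ∀ r u → K s t ≤ r + u →
      + count r s t u ≡ + 1 - g3 (+ q) + r + (+ q - + 1) * s + (+ q - + 1) * t + u
    count-formula r u K≤r+u = trans (count≡T+S+P r u K≤r+u) (trans (cong₂ (λ x y → x + y + P) (T-affine r) (S-affine u))
      (linear-combination₁ 1ℤ (identity (T 0ℤ) (S 0ℤ) P r u (g3 Q) Q s t) T0+S0+P))
      where
      identity : ∀ T0 S0 P r u g Q s t → T0 + r * 1ℤ + (S0 + u * 1ℤ) + P
        ≡ + 1 - g + r + (Q - + 1) * s + (Q - + 1) * t + u + 1ℤ * ((T0 + S0 + P) - (1ℤ - g + (Q - 1ℤ) * s + (Q - 1ℤ) * t))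
      identity = solve-∀

¬IsPrimePower-0 : ¬ IsPrimePower 0
¬IsPrimePower-0 (p , m , p-prime , _ , 0≡p^m) =
  ℕ.≢-nonZero⁻¹ p {{prime⇒nonZero p-prime}} (ℕP.m^n≡0⇒m≡0 p m (sym 0≡p^m))

proposition2p2 : (q : ℕ) → IsPrimePower q → (s t u : ℤ) →
    Σ ℤ λ R → (r : ℤ) → R ≤ r →
      Σ ℕ λ n → HasCard (Ω (+ q) r s t u) n ×
        (+ n ≡ + 1 - g3 (+ q) + r + (+ q - + 1) * s + (+ q - + 1) * t + u)
proposition2p2 zero     0-prime-power s t u = ⊥-elim (¬IsPrimePower-0 0-prime-power)
proposition2p2 (suc q₀) _             s t u = K s t - u , λ r K-u≤r →
  count r s t u , count-card r s t u , Formula.count-formula s t r u (≤-respects-diff (identity r u (K s t)) K-u≤r)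
  where
  open Lattice q₀
  identity : ∀ r u K → r - (K - u) ≡ r + u - K
  identity = solve-∀
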